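{- Let $\ell,k,m_1,\ldots,m_k$ be integers with $1\le \ell<k$ and $m_i\ge 2$ for all $i$. Let $s=m_1+\ldots+m_\ell$, $t=m_{\ell+1}+\ldots+m_k$, and assume $s<t$. Then $\mathrm{OP}^\ast(m_1,\ldots,m_k)$ has a solution if all of the following hold: (1) $\mathrm{OP}^\ast(m_1,\ldots,m_\ell)$ has a solution; (2) there exist a decomposition $\{D',D''\}$ of $K_t^\ast$ and non-negative integers $s_1,\ldots,s_k,t_1,\ldots,t_k$ such that: (a) $D'$ admits a decomposition into exactly $s-1$ spanning subdigraphs, each a disjoint union of directed cycles of lengths $m_{\ell+1},\ldots,m_k$; (b) $s_1+\ldots+s_k=s$; (c) $m_i=2s_i+t_i$ for $i=1,\ldots,k$; (d) $D''$ admits a decomposition $\{H_0,\ldots,H_{t-1}\}$ such that, for a cyclic permutation $\rho$ of order $t$ on $V(K_t^\ast)$ and for all $j\in\mathbb{Z}_t$: $V(H_j)=\rho^j(V(H_0))$; and $H_j=D_1^{(j)}\,\dot\cup\,\cdots\,\dot\cup\, D_k^{(j)}$ (vertex-disjoint union) where for each $i=1,\ldots,k$, $D_i^{(j)}\cong \vec P_{t_i}$ if $t_i<m_i$ and $D_i^{(j)}\cong \vec C_{m_i}$ if $t_i=m_i$, and if $D_i^{(0)}$ is a directed $(x,y)$-path for some vertices $x,y$, then $D_i^{(j)}$ is a directed $(\rho^j(x),\rho^j(y))$-path.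
   Context: $K_n^\ast$ is the complete symmetric digraph of order $n$. For integers $m_1,\ldots,m_k\ge 2$ with $n=m_1+\ldots+m_k$, $\mathrm{OP}^\ast(m_1,\ldots,m_k)$ asks for a decomposition of $K_n^\ast$ into spanning subdigraphs each a disjoint union of $k$ directed cycles of lengths $m_1,\ldots,m_k$ (a solution). A decomposition of a digraph $D$ is a set of subdigraphs whose arc sets partition $A(D)$. $\vec C_m$ is the directed cycle of length $m$ and $\vec P_m$ is the directed path with $m$ arcs ($\vec P_0$ is a single vertex). -}

module Defs where

open import Level using (0ℓ)
open import Data.Nat using (ℕ; zero; suc; _+_; _*_; _∸_; _≤_; _<_; z≤n; s≤s; NonZero)
open import Data.Nat.Properties using (m+[n∸m]≡n; m<n⇒0<n)
open import Data.Nat.DivMod using (_mod_)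
open import Data.Fin using (Fin; zero; suc; toℕ; inject≤; inject₁; cast; _↑ʳ_; fromℕ)
open import Data.Fin.Permutation using (Permutation′; _⟨$⟩ʳ_)
open import Data.Product using (Σ; ∃; ∃-syntax; _×_; _,_)
open import Data.Empty using (⊥)
open import Relation.Binary.PropositionalEquality using (_≡_; _≢_)
open import Function using (_∘_)
open import Function.Bundles using (_⇔_)
open import Function.Definitions using (Injective)

-- Digraphs on the vertex set Fin n (subdigraphs of K_n^*, or of any digraph
-- on Fin n): a vertex predicate and an arc predicate, arcs joining vertices.

record Digraph (n : ℕ) : Set₁ where
  field
    Vx     : Fin n → Set
    Arc    : Fin n → Fin n → Set
    closed : ∀ {u v} → Arc u v → Vx u × Vx v
open Digraph public

K* : (n : ℕ) → Digraph n
K* n = record { Vx = λ _ → Fin n ; Arc = λ u v → u ≢ v ; closed = λ {u} {v} _ → u , v }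

_⊑_ : ∀ {n} → Digraph n → Digraph n → Set
F ⊑ D = (∀ v → Vx F v → Vx D v) × (∀ u v → Arc F u v → Arc D u v)

SpanningSub : ∀ {n} → Digraph n → Digraph n → Set
SpanningSub D F = F ⊑ D × (∀ v → Vx D v → Vx F v)

Decomposition : ∀ {n r} → Digraph n → (Fin r → Digraph n) → Set
Decomposition D F =
  (∀ i → F i ⊑ D) ×
  (∀ u v → Arc D u v → Σ _ λ i → Arc (F i) u v × (∀ j → Arc (F j) u v → j ≡ i))

pair : ∀ {n} → Digraph n → Digraph n → Fin 2 → Digraph n
pair D' D'' zero       = D'
pair D' D'' (suc zero) = D''

DisjointUnion : ∀ {n k} → Digraph n → (Fin k → Digraph n) → Set
DisjointUnion H C =
  (∀ v → Vx H v ⇔ (∃[ i ] Vx (C i) v)) ×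
  (∀ u v → Arc H u v ⇔ (∃[ i ] Arc (C i) u v)) ×
  (∀ i j → i ≢ j → ∀ v → Vx (C i) v → Vx (C j) v → ⊥)

cycSuc : ∀ {m} → Fin m → Fin m
cycSuc {suc m} i = suc (toℕ i) mod (suc m)

-- D is a directed cycle of length m, i.e. D ≅ C⃗_m: D is the image of the
-- standard cycle 0 → 1 → … → m-1 → 0 under an injective vertex map c.
IsCycle : ∀ {n} → ℕ → Digraph n → Set
IsCycle {n} m D = Σ (Fin m → Fin n) λ c → Injective _≡_ _≡_ c ×
  (∀ v → Vx D v ⇔ (∃[ i ] c i ≡ v)) ×
  (∀ u v → Arc D u v ⇔ (∃[ i ] (u ≡ c i × v ≡ c (cycSuc i))))

-- D is a directed (x,y)-path with p arcs: the image of the standard path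
-- 0 → 1 → … → p under an injective vertex map c with c 0 = x, c p = y.
IsPathFromTo : ∀ {n} → ℕ → Fin n → Fin n → Digraph n → Set
IsPathFromTo {n} p x y D = Σ (Fin (suc p) → Fin n) λ c → Injective _≡_ _≡_ c ×
  c zero ≡ x × c (fromℕ p) ≡ y ×
  (∀ v → Vx D v ⇔ (∃[ i ] c i ≡ v)) ×
  (∀ u v → Arc D u v ⇔ (∃[ i ] (u ≡ c (inject₁ i) × v ≡ c (suc i))))

IsPath : ∀ {n} → ℕ → Digraph n → Set
IsPath p D = ∃[ x ] ∃[ y ] IsPathFromTo p x y D

IsXYPath : ∀ {n} → Fin n → Fin n → Digraph n → Set
IsXYPath x y D = ∃[ p ] IsPathFromTo p x y D

CycleUnion : ∀ {n k} → (Fin k → ℕ) → Digraph n → Set₁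
CycleUnion {n} {k} m F =
  Σ (Fin k → Digraph n) λ C → (∀ i → IsCycle (m i) (C i)) × DisjointUnion F C

sumF : ∀ {k} → (Fin k → ℕ) → ℕ
sumF {zero}  f = 0
sumF {suc k} f = f zero + sumF (f ∘ suc)

OPstar : ∀ {k} → (Fin k → ℕ) → Set₁
OPstar m = let n = sumF m in
  Σ ℕ λ r → Σ (Fin r → Digraph n) λ F →
    Decomposition (K* n) F × (∀ i → SpanningSub (K* n) (F i) × CycleUnion m (F i))

firstPart : ∀ {A : Set} {k ℓ} → ℓ ≤ k → (Fin k → A) → Fin ℓ → A
firstPart ℓ≤k m i = m (inject≤ i ℓ≤k)

lastPart : ∀ {A : Set} {k ℓ} → ℓ ≤ k → (Fin k → A) → Fin (k ∸ ℓ) → A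
lastPart {ℓ = ℓ} ℓ≤k m j = m (cast (m+[n∸m]≡n ℓ≤k) (ℓ ↑ʳ j))

_^_ : ∀ {t} → Permutation′ t → ℕ → Fin t → Fin t
(ρ ^ zero) x = x
(ρ ^ suc j) x = ρ ⟨$⟩ʳ ((ρ ^ j) x)

-- ρ is a cyclic permutation of order t on Fin t (a single t-cycle):
-- there is an enumeration x_0,…,x_{t-1} of all vertices with ρ(x_i) = x_{i+1 mod t}
IsCyclicPerm : ∀ {t} → Permutation′ t → Set
IsCyclicPerm {t} ρ = Σ (Fin t → Fin t) λ c → Injective _≡_ _≡_ c × (∀ i → ρ ⟨$⟩ʳ c i ≡ c (cycSuc i))

zeroOf : ∀ {t} → 0 < t → Fin t
zeroOf {suc _} _ = zero

Condition2 : ∀ {k} (ℓ : ℕ) → ℓ ≤ k → (Fin k → ℕ) → (s t : ℕ) → s < t → Set₁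
Condition2 {k} ℓ ℓ≤k m s t s<t =
  let H₀ = zeroOf (m<n⇒0<n s<t) in
  Σ (Digraph t) λ D' → Σ (Digraph t) λ D'' →
    Decomposition (K* t) (pair D' D'') ×
    -- (a)
    (Σ (Fin (s ∸ 1) → Digraph t) λ F →
       Decomposition D' F × (∀ i → SpanningSub D' (F i) × CycleUnion (lastPart ℓ≤k m) (F i))) ×
    Σ (Fin k → ℕ) λ sᵢ → Σ (Fin k → ℕ) λ tᵢ →
      -- (b)
      sumF sᵢ ≡ s ×
      -- (c)
      (∀ i → m i ≡ 2 * sᵢ i + tᵢ i) ×
      -- (d)
      (Σ (Fin t → Digraph t) λ H → Decomposition D'' H ×
        Σ (Permutation′ t) λ ρ → IsCyclicPerm ρ ×
        Σ (Fin t → Fin k → Digraph t) λ Dᵢ →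
          ∀ j → (∀ v → Vx (H j) v ⇔ (∃[ u ] (Vx (H H₀) u × (ρ ^ toℕ j) u ≡ v))) ×
                DisjointUnion (H j) (Dᵢ j) ×
                (∀ i → (tᵢ i < m i → IsPath (tᵢ i) (Dᵢ j i)) ×
                       (tᵢ i ≡ m i → IsCycle (m i) (Dᵢ j i)) ×
                       (∀ x y → IsXYPath x y (Dᵢ H₀ i) →
                                IsXYPath ((ρ ^ toℕ j) x) ((ρ ^ toℕ j) y) (Dᵢ j i))))

-- Split the vertices of K*_(s+t) into S (s vertices) and T (t vertices). The solution of
-- OP*(m₁,…,m_ℓ) on S has s − 1 factors, as many as the decomposition (a) of D′ on T; pairing
-- them gives s − 1 2-factors of K*_(s+t) with cycle lengths m₁,…,m_k, covering all arcs
-- inside S and all arcs of D′.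
--
-- The arcs of D″ and all arcs between S and T are covered by t further 2-factors, one for
-- each j ∈ ℤ_t. Partition S into blocks of sizes s_i, and let the β-vertices be the
-- Σ (s_i − 1) = t − |V(H₀)| vertices of T outside V(H₀). In factor j, a cycle component
-- of H_j is kept, and a path component D_i^(j) is closed into a cycle of length t_i + 2s_i
-- = m_i through the s_i vertices of block i alternating with s_i − 1 vertices ρʲ(β); these
-- lie outside V(H_j) = ρʲ(V(H₀)). The end vertices of D_i^(j) are ρʲ of those of D_i^(0),
-- so in factor j every vertex of S has out- and in-neighbour ρʲ(z) for a z independent of
-- j, and since ρ is a t-cycle every arc between S and T is used exactly once.

module Submission where

open import Defs
open import Data.Nat using (ℕ; zero; suc; _+_; _*_; _∸_; _≤_; _<_; z≤n; s≤s)
open import Data.Nat.Properties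
open import Data.Nat.DivMod using (_%_; m<n⇒m%n≡m; n%n≡0)
open import Data.Nat.Solver using (module +-*-Solver)
open import Data.Fin as Fin using (Fin; zero; suc; toℕ; fromℕ; fromℕ<; inject₁; inject≤; cast; _↑ˡ_; _↑ʳ_; splitAt; join; punchIn; punchOut)
open import Data.Fin.Properties as Finₚ using (toℕ-injective; toℕ-fromℕ<; toℕ-cast; toℕ<n; toℕ-inject₁; toℕ-fromℕ; any?; injective⇒≤; cast-involutive)
open import Data.Fin.Relation.Unary.Top using (view; ‵fromℕ; ‵inject₁; view-fromℕ; view-inject₁)
open import Data.Fin.Permutation using (Permutation′; _⟨$⟩ʳ_; _⟨$⟩ˡ_; inverseˡ)
open import Data.Product as Product using (Σ; ∃; ∃-syntax; _×_; _,_; proj₁; proj₂; uncurry)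
open import Data.Product.Properties using (,-injectiveʳ-UIP)
open import Axiom.UniquenessOfIdentityProofs using (module Decidable⇒UIP)
open import Data.Sum using (_⊎_; inj₁; inj₂; [_,_]′)
open import Data.Unit using (⊤; tt)
open import Data.Empty using (⊥-elim)
open import Relation.Nullary using (¬_; ¬?; yes; no; Dec; contradiction)
open import Relation.Unary using (Decidable)
open import Relation.Binary.PropositionalEquality
open import Function using (_∘_; id)
open import Function.Bundles using (_⇔_; mk⇔; _↔_; mk↔ₛ′; Equivalence; Inverse)
open import Function.Definitions using (Injective; StrictlySurjective)
open import Function.Properties.Inverse using (↔-refl)

open Equivalence using (to; from)

-- Finite sets

injective⇒surjective : ∀ {n} {f : Fin n → Fin n} → Injective _≡_ _≡_ f → StrictlySurjective _≡_ f
injective⇒surjective {suc n} {f} f-inj y with any? (λ x → f x Fin.≟ y)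
... | yes hit = hit
... | no miss = contradiction (injective⇒≤ {f = punchOut ∘ f≢y} f≢y-inj) 1+n≰n
  where
  f≢y : ∀ x → y ≢ f x
  f≢y x e = miss (x , sym e)
  f≢y-inj : ∀ {x x′} → punchOut (f≢y x) ≡ punchOut (f≢y x′) → x ≡ x′
  f≢y-inj e = f-inj (Finₚ.punchOut-injective (f≢y _) (f≢y _) e)

surjective⇒injective : ∀ {n} {f : Fin n → Fin n} → StrictlySurjective _≡_ f → Injective _≡_ _≡_ f
surjective⇒injective {f = f} f-surj = f-inj
  where
  g = proj₁ ∘ f-surj
  f∘g : ∀ y → f (g y) ≡ y
  f∘g = proj₂ ∘ f-surj
  g-inj : Injective _≡_ _≡_ g
  g-inj {a} {b} e = trans (sym (f∘g a)) (trans (cong f e) (f∘g b))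
  -- g is a right inverse of f, and it is onto because it is injective
  f-inj : Injective _≡_ _≡_ f
  f-inj {x} {y} fx≡fy with injective⇒surjective g-inj x | injective⇒surjective g-inj y
  ... | x′ , refl | y′ , refl = cong g (trans (sym (f∘g x′)) (trans fx≡fy (f∘g y′)))

cast-injective : ∀ {m n} .(eq : m ≡ n) → Injective _≡_ _≡_ (cast eq)
cast-injective eq {x} {y} e = toℕ-injective (trans (sym (toℕ-cast eq x)) (trans (cong toℕ e) (toℕ-cast eq y)))

ΣFin : ∀ {k} → (Fin k → ℕ) → Set
ΣFin {k} f = Σ (Fin k) (Fin ∘ f)

ΣFin-,-injectiveʳ : ∀ {k} {f : Fin k → ℕ} {i} {q q′ : Fin (f i)} → _≡_ {A = ΣFin f} (i , q) (i , q′) → q ≡ q′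
ΣFin-,-injectiveʳ = ,-injectiveʳ-UIP (Decidable⇒UIP.≡-irrelevant Fin._≟_)

fromΣ : ∀ {k} (f : Fin k → ℕ) → ΣFin f → Fin (sumF f)
fromΣ {suc k} f (zero , q) = q ↑ˡ sumF (f ∘ suc)
fromΣ {suc k} f (suc i , q) = f zero ↑ʳ fromΣ (f ∘ suc) (i , q)

toΣ : ∀ {k} (f : Fin k → ℕ) → Fin (sumF f) → ΣFin f
toΣ {suc k} f p = [ zero ,_ , Product.map suc id ∘ toΣ (f ∘ suc) ]′ (splitAt (f zero) p)

toΣ-fromΣ : ∀ {k} (f : Fin k → ℕ) x → toΣ f (fromΣ f x) ≡ x
toΣ-fromΣ {suc k} f (zero , q) rewrite Finₚ.splitAt-↑ˡ (f zero) q (sumF (f ∘ suc)) = refl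
toΣ-fromΣ {suc k} f (suc i , q)
  rewrite Finₚ.splitAt-↑ʳ (f zero) (sumF (f ∘ suc)) (fromΣ (f ∘ suc) (i , q))
        | toΣ-fromΣ (f ∘ suc) (i , q) = refl

fromΣ-toΣ : ∀ {k} (f : Fin k → ℕ) p → fromΣ f (toΣ f p) ≡ p
fromΣ-toΣ {suc k} f p with splitAt (f zero) p in eq
... | inj₁ q = Finₚ.splitAt⁻¹-↑ˡ eq
... | inj₂ p′ = trans (cong (f zero ↑ʳ_) (fromΣ-toΣ (f ∘ suc) p′)) (Finₚ.splitAt⁻¹-↑ʳ eq)

fromΣ-injective : ∀ {k} (f : Fin k → ℕ) → Injective _≡_ _≡_ (fromΣ f)
fromΣ-injective f {x} {y} e = trans (sym (toΣ-fromΣ f x)) (trans (cong (toΣ f) e) (toΣ-fromΣ f y))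

ΣFin-injective⇒surjective : ∀ {k n} (len : Fin k → ℕ) (g : ΣFin len → Fin n) →
  Injective _≡_ _≡_ g → sumF len ≡ n → StrictlySurjective _≡_ g
ΣFin-injective⇒surjective len g g-inj eq v =
  let (z , gz≡v) = injective⇒surjective G-inj v in decode z , gz≡v
  where
  decode = toΣ len ∘ cast (sym eq)
  G = g ∘ decode
  G-inj : Injective _≡_ _≡_ G
  G-inj {z} {z′} e = cast-injective (sym eq)
    (trans (sym (fromΣ-toΣ len _)) (trans (cong (fromΣ len) (g-inj e)) (fromΣ-toΣ len _)))

record Enumeration {n} (P : Fin n → Set) : Set where
  field
    size : ℕ
    elem : Fin size → Fin n
    elem-injective : Injective _≡_ _≡_ elem
    elem-∈ : ∀ i → P (elem i)
    elem-complete : ∀ v → P v → ∃ λ i → elem i ≡ v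

enumerate : ∀ {n} {P : Fin n → Set} → Decidable P → Enumeration P
enumerate {zero} P? = record
  { size = 0 ; elem = λ () ; elem-injective = λ {x} → ⊥-elim (Finₚ.¬Fin0 x)
  ; elem-∈ = λ () ; elem-complete = λ () }
enumerate {suc n} {P} P? with enumerate (P? ∘ suc) | P? zero
... | E | yes P0 = record
  { size = suc size ; elem = elem′ ; elem-injective = elem′-inj ; elem-∈ = elem′-∈ ; elem-complete = complete }
  where
  open Enumeration E
  elem′ : Fin (suc size) → Fin (suc n)
  elem′ zero = zero
  elem′ (suc i) = suc (elem i)
  elem′-inj : Injective _≡_ _≡_ elem′
  elem′-inj {zero} {zero} _ = refl
  elem′-inj {suc i} {suc j} e = cong suc (elem-injective (Finₚ.suc-injective e))
  elem′-∈ : ∀ i → P (elem′ i)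
  elem′-∈ zero = P0
  elem′-∈ (suc i) = elem-∈ i
  complete : ∀ v → P v → ∃ λ i → elem′ i ≡ v
  complete zero _ = zero , refl
  complete (suc v) Pv = Product.map suc (cong suc) (elem-complete v Pv)
... | E | no ¬P0 = record
  { size = size ; elem = suc ∘ elem ; elem-injective = elem-injective ∘ Finₚ.suc-injective
  ; elem-∈ = elem-∈ ; elem-complete = complete }
  where
  open Enumeration E
  complete : ∀ v → P v → ∃ λ i → suc (elem i) ≡ v
  complete zero P0 = ⊥-elim (¬P0 P0)
  complete (suc v) Pv = Product.map id (cong suc) (elem-complete v Pv)

disjoint-cover-sizes : ∀ {a c n} (V : Fin a → Fin n) (W : Fin c → Fin n) →
  Injective _≡_ _≡_ V → Injective _≡_ _≡_ W → (∀ x y → V x ≢ W y) →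
  (∀ v → (∃ λ x → V x ≡ v) ⊎ (∃ λ y → W y ≡ v)) → a + c ≡ n
disjoint-cover-sizes {a} {c} {n} V W V-inj W-inj V≢W cover =
  ≤-antisym (injective⇒≤ {f = [V,W] ∘ splitAt a} [V,W]∘split-inj)
            (injective⇒≤ {f = join a c ∘ index} index-inj)
  where
  [V,W] : Fin a ⊎ Fin c → Fin n
  [V,W] = [ V , W ]′
  [V,W]-inj : Injective _≡_ _≡_ [V,W]
  [V,W]-inj {inj₁ x} {inj₁ x′} e = cong inj₁ (V-inj e)
  [V,W]-inj {inj₁ x} {inj₂ y} e = ⊥-elim (V≢W x y e)
  [V,W]-inj {inj₂ y} {inj₁ x} e = ⊥-elim (V≢W x y (sym e))
  [V,W]-inj {inj₂ y} {inj₂ y′} e = cong inj₂ (W-inj e)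
  [V,W]∘split-inj : Injective _≡_ _≡_ ([V,W] ∘ splitAt a)
  [V,W]∘split-inj {z} {z′} e =
    trans (sym (Finₚ.join-splitAt a c z))
          (trans (cong (join a c) ([V,W]-inj {splitAt a z} {splitAt a z′} e)) (Finₚ.join-splitAt a c z′))
  index : Fin n → Fin a ⊎ Fin c
  index v = [ inj₁ ∘ proj₁ , inj₂ ∘ proj₁ ]′ (cover v)
  [V,W]∘index : ∀ v → [V,W] (index v) ≡ v
  [V,W]∘index v with cover v
  ... | inj₁ (_ , e) = e
  ... | inj₂ (_ , e) = e
  index-inj : Injective _≡_ _≡_ (join a c ∘ index)
  index-inj {v} {v′} e = trans (sym ([V,W]∘index v))
    (trans (cong [V,W] (trans (sym (Finₚ.splitAt-join a c (index v)))
                              (trans (cong (splitAt a) e) (Finₚ.splitAt-join a c (index v′)))))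
           ([V,W]∘index v′))

sumF-cong : ∀ {k} {f g : Fin k → ℕ} → (∀ i → f i ≡ g i) → sumF f ≡ sumF g
sumF-cong {zero} _ = refl
sumF-cong {suc k} e = cong₂ _+_ (e zero) (sumF-cong (e ∘ suc))

sumF-distrib-+ : ∀ {k} (f g : Fin k → ℕ) → sumF (λ i → f i + g i) ≡ sumF f + sumF g
sumF-distrib-+ {zero} f g = refl
sumF-distrib-+ {suc k} f g rewrite sumF-distrib-+ (f ∘ suc) (g ∘ suc) =
  +-*-Solver.solve 4 (λ a b c d → (a :+ b) :+ (c :+ d) := (a :+ c) :+ (b :+ d)) refl (f zero) (g zero) _ _
  where open +-*-Solver

sumF-firstPart-lastPart : ∀ {k ℓ} (ℓ≤k : ℓ ≤ k) (m : Fin k → ℕ) →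
  sumF m ≡ sumF (firstPart ℓ≤k m) + sumF (lastPart ℓ≤k m)
sumF-firstPart-lastPart {ℓ = zero} z≤n m = sumF-cong (λ i → cong m (sym (Finₚ.cast-is-id _ i)))
sumF-firstPart-lastPart {ℓ = suc ℓ} (s≤s ℓ≤k) m =
  trans (cong (m zero +_) (sumF-firstPart-lastPart ℓ≤k (m ∘ suc))) (sym (+-assoc (m zero) _ _))

≤-sumF : ∀ {k} (f : Fin k → ℕ) (i : Fin k) → f i ≤ sumF f
≤-sumF f zero = m≤m+n (f zero) _
≤-sumF f (suc i) = ≤-trans (≤-sumF (f ∘ suc) i) (m≤n+m _ (f zero))

↑ˡ≢↑ʳ : ∀ {s t} (a : Fin s) (w : Fin t) → a ↑ˡ t ≢ s ↑ʳ w
↑ˡ≢↑ʳ {s} {t} a w e = <⇒≱ (toℕ<n a) (subst (s ≤_) (sym a≡s+w) (m≤m+n s (toℕ w)))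
  where
  a≡s+w : toℕ a ≡ s + toℕ w
  a≡s+w = trans (sym (Finₚ.toℕ-↑ˡ a t)) (trans (cong toℕ e) (Finₚ.toℕ-↑ʳ s w))

data Side (s t : ℕ) : Fin (s + t) → Set where
  left  : (a : Fin s) → Side s t (a ↑ˡ t)
  right : (w : Fin t) → Side s t (s ↑ʳ w)

side : ∀ {s t} (v : Fin (s + t)) → Side s t v
side {s} {t} v with splitAt s v in eq
... | inj₁ a = subst (Side s t) (Finₚ.splitAt⁻¹-↑ˡ eq) (left a)
... | inj₂ w = subst (Side s t) (Finₚ.splitAt⁻¹-↑ʳ eq) (right w)

firstLast↔ : ∀ {k ℓ} (ℓ≤k : ℓ ≤ k) → (Fin ℓ ⊎ Fin (k ∸ ℓ)) ↔ Fin k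
firstLast↔ {k} {ℓ} ℓ≤k = mk↔ₛ′ (cast eq ∘ join ℓ (k ∸ ℓ)) (splitAt ℓ ∘ cast (sym eq))
  (λ i → trans (cong (cast eq) (Finₚ.join-splitAt ℓ (k ∸ ℓ) _)) (cast-involutive eq (sym eq) i))
  (λ x → trans (cong (splitAt ℓ) (cast-involutive (sym eq) eq _)) (Finₚ.splitAt-join ℓ (k ∸ ℓ) x))
  where
  eq = m+[n∸m]≡n ℓ≤k

firstLast↔-first : ∀ {k ℓ} (ℓ≤k : ℓ ≤ k) (i : Fin ℓ) → Inverse.to (firstLast↔ ℓ≤k) (inj₁ i) ≡ inject≤ i ℓ≤k
firstLast↔-first {k} {ℓ} ℓ≤k i = toℕ-injective
  (trans (toℕ-cast _ (i ↑ˡ (k ∸ ℓ))) (trans (Finₚ.toℕ-↑ˡ i (k ∸ ℓ)) (sym (Finₚ.toℕ-inject≤ i ℓ≤k))))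

-- Cyclic successor and cyclic permutations

toℕ-cycSuc : ∀ {n} (p : Fin n) → suc (toℕ p) < n → toℕ (cycSuc p) ≡ suc (toℕ p)
toℕ-cycSuc {suc n} p lt = trans (toℕ-fromℕ< _) (m<n⇒m%n≡m lt)

cycSuc-inject₁ : ∀ {n} (q : Fin n) → cycSuc (inject₁ q) ≡ suc q
cycSuc-inject₁ {n} q = toℕ-injective (trans (toℕ-cycSuc (inject₁ q) (s≤s q<n)) (cong suc (toℕ-inject₁ q)))
  where
  q<n : toℕ (inject₁ q) < n
  q<n = subst (_< n) (sym (toℕ-inject₁ q)) (toℕ<n q)

cycSuc-fromℕ : ∀ n → cycSuc (fromℕ n) ≡ zero
cycSuc-fromℕ n = toℕ-injective
  (trans (toℕ-fromℕ< _) (trans (cong (λ x → suc x % suc n) (toℕ-fromℕ n)) (n%n≡0 (suc n))))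

cycSuc-≢ : ∀ {n} → 2 ≤ n → (p : Fin n) → cycSuc p ≢ p
cycSuc-≢ {suc zero} (s≤s ()) _
cycSuc-≢ {suc (suc n)} _ p with view p
... | ‵fromℕ rewrite cycSuc-fromℕ (suc n) = λ ()
... | ‵inject₁ q rewrite cycSuc-inject₁ q = λ e → 1+n≢n (trans (cong toℕ e) (toℕ-inject₁ q))

cycSuc^ : ∀ {n} → ℕ → Fin n → Fin n
cycSuc^ zero = id
cycSuc^ (suc d) = cycSuc ∘ cycSuc^ d

cycSuc^-+ : ∀ {n} a b (i : Fin n) → cycSuc^ (a + b) i ≡ cycSuc^ a (cycSuc^ b i)
cycSuc^-+ zero b i = refl
cycSuc^-+ (suc a) b i = cong cycSuc (cycSuc^-+ a b i)

toℕ-cycSuc^ : ∀ {n} d → d < suc n → toℕ (cycSuc^ d (zero {n})) ≡ d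
toℕ-cycSuc^ zero _ = refl
toℕ-cycSuc^ (suc d) lt =
  trans (toℕ-cycSuc (cycSuc^ d zero) (subst (λ x → suc x < _) (sym IH) lt)) (cong suc IH)
  where
  IH = toℕ-cycSuc^ d (<-trans (n<1+n d) lt)

cycSuc^-toℕ : ∀ {n} (i : Fin (suc n)) → cycSuc^ (toℕ i) zero ≡ i
cycSuc^-toℕ i = toℕ-injective (toℕ-cycSuc^ (toℕ i) (toℕ<n i))

cycSuc^-period : ∀ n → cycSuc^ (suc n) (zero {n}) ≡ zero
cycSuc^-period n = trans (cong cycSuc (toℕ-injective (trans (toℕ-cycSuc^ n (n<1+n n)) (sym (toℕ-fromℕ n)))))
                         (cycSuc-fromℕ n)

cycSuc^-reaches : ∀ {n} (i i′ : Fin (suc n)) → ∃ λ (j : Fin (suc n)) → cycSuc^ (toℕ j) i ≡ i′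
cycSuc^-reaches {n} i i′ with toℕ i ≤? toℕ i′
... | yes a≤b = fromℕ< d<T , (begin
  cycSuc^ (toℕ (fromℕ< d<T)) i     ≡⟨ cong (λ d → cycSuc^ d i) (toℕ-fromℕ< d<T) ⟩
  cycSuc^ (b ∸ a) i                ≡⟨ cong (cycSuc^ (b ∸ a)) (sym (cycSuc^-toℕ i)) ⟩
  cycSuc^ (b ∸ a) (cycSuc^ a zero) ≡⟨ sym (cycSuc^-+ (b ∸ a) a zero) ⟩
  cycSuc^ (b ∸ a + a) zero         ≡⟨ cong (λ d → cycSuc^ d zero) (m∸n+n≡m a≤b) ⟩
  cycSuc^ b zero                   ≡⟨ cycSuc^-toℕ i′ ⟩
  i′                               ∎)
  where
  open ≡-Reasoning
  a = toℕ i
  b = toℕ i′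
  d<T : b ∸ a < suc n
  d<T = ≤-<-trans (m∸n≤m b a) (toℕ<n i′)
... | no a≰b = fromℕ< d<T , (begin
  cycSuc^ (toℕ (fromℕ< d<T)) i     ≡⟨ cong (λ d → cycSuc^ d i) (toℕ-fromℕ< d<T) ⟩
  cycSuc^ (T ∸ a + b) i            ≡⟨ cong (cycSuc^ (T ∸ a + b)) (sym (cycSuc^-toℕ i)) ⟩
  cycSuc^ (T ∸ a + b) (cycSuc^ a zero) ≡⟨ sym (cycSuc^-+ (T ∸ a + b) a zero) ⟩
  cycSuc^ (T ∸ a + b + a) zero     ≡⟨ cong (λ d → cycSuc^ d zero) d+a≡b+T ⟩
  cycSuc^ (b + T) zero             ≡⟨ cycSuc^-+ b T zero ⟩
  cycSuc^ b (cycSuc^ T zero)       ≡⟨ cong (cycSuc^ b) (cycSuc^-period n) ⟩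
  cycSuc^ b zero                   ≡⟨ cycSuc^-toℕ i′ ⟩
  i′                               ∎)
  where
  open ≡-Reasoning
  T = suc n
  a = toℕ i
  b = toℕ i′
  T∸a+a≡T : T ∸ a + a ≡ T
  T∸a+a≡T = m∸n+n≡m (<⇒≤ (toℕ<n i))
  d<T : T ∸ a + b < T
  d<T = subst (T ∸ a + b <_) T∸a+a≡T (+-monoʳ-< (T ∸ a) (≰⇒> a≰b))
  d+a≡b+T : T ∸ a + b + a ≡ b + T
  d+a≡b+T = trans (+-*-Solver.solve 3 (λ x b a → x :+ b :+ a := b :+ (x :+ a)) refl (T ∸ a) b a)
                  (cong (b +_) T∸a+a≡T)
    where open +-*-Solver

^-injective : ∀ {n} (ρ : Permutation′ n) j → Injective _≡_ _≡_ (ρ ^ j)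
^-injective ρ zero e = e
^-injective ρ (suc j) e = ^-injective ρ j (trans (sym (inverseˡ ρ)) (trans (cong (ρ ⟨$⟩ˡ_) e) (inverseˡ ρ)))

^-cycSuc^ : ∀ {n} {ρ : Permutation′ n} {c : Fin n → Fin n} → (∀ i → ρ ⟨$⟩ʳ c i ≡ c (cycSuc i)) →
  ∀ d i → (ρ ^ d) (c i) ≡ c (cycSuc^ d i)
^-cycSuc^ step zero i = refl
^-cycSuc^ {ρ = ρ} step (suc d) i = trans (cong (ρ ⟨$⟩ʳ_) (^-cycSuc^ step d i)) (step (cycSuc^ d i))

orbit : ∀ {n} → Permutation′ n → Fin n → Fin n → Fin n
orbit ρ z j = (ρ ^ toℕ j) z

orbit-surjective : ∀ {n} {ρ : Permutation′ (suc n)} → IsCyclicPerm ρ → ∀ z → StrictlySurjective _≡_ (orbit ρ z)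
orbit-surjective (c , c-inj , step) z w with injective⇒surjective c-inj z | injective⇒surjective c-inj w
... | i , refl | i′ , refl =
  let (j , e) = cycSuc^-reaches i i′ in j , trans (^-cycSuc^ step (toℕ j) i) (cong c e)

orbit-injective : ∀ {n} {ρ : Permutation′ (suc n)} → IsCyclicPerm ρ → ∀ z → Injective _≡_ _≡_ (orbit ρ z)
orbit-injective ρ-cyclic z = surjective⇒injective (orbit-surjective ρ-cyclic z)

-- Paths, cycles and unions of cycles

module PathFromTo {n p x y} {D : Digraph n} (P : IsPathFromTo p x y D) where

  vertex : Fin (suc p) → Fin n
  vertex = proj₁ P

  vertex-injective : Injective _≡_ _≡_ vertex
  vertex-injective = proj₁ (proj₂ P)

  vertex-first : vertex zero ≡ x
  vertex-first = proj₁ (proj₂ (proj₂ P))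

  vertex-last : vertex (fromℕ p) ≡ y
  vertex-last = proj₁ (proj₂ (proj₂ (proj₂ P)))

  vx⇔ : ∀ v → Vx D v ⇔ (∃ λ i → vertex i ≡ v)
  vx⇔ = proj₁ (proj₂ (proj₂ (proj₂ (proj₂ P))))

  arc⇔ : ∀ u v → Arc D u v ⇔ (∃ λ i → u ≡ vertex (inject₁ i) × v ≡ vertex (suc i))
  arc⇔ = proj₂ (proj₂ (proj₂ (proj₂ (proj₂ P))))

module CycleOf {n L} {D : Digraph n} (C : IsCycle L D) where

  vertex : Fin L → Fin n
  vertex = proj₁ C

  vertex-injective : Injective _≡_ _≡_ vertex
  vertex-injective = proj₁ (proj₂ C)

  vx⇔ : ∀ v → Vx D v ⇔ (∃ λ i → vertex i ≡ v)
  vx⇔ = proj₁ (proj₂ (proj₂ C))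

  arc⇔ : ∀ u v → Arc D u v ⇔ (∃ λ i → u ≡ vertex i × v ≡ vertex (cycSuc i))
  arc⇔ = proj₂ (proj₂ (proj₂ C))

module CycleUnionOf {n k} {len : Fin k → ℕ} {F : Digraph n} (F-cycles : CycleUnion len F) where

  component : Fin k → Digraph n
  component = proj₁ F-cycles

  isCycle : ∀ i → IsCycle (len i) (component i)
  isCycle = proj₁ (proj₂ F-cycles)

  private
    module C (i : Fin k) = CycleOf {D = component i} (isCycle i)
    arcs⇔ = proj₁ (proj₂ (proj₂ (proj₂ F-cycles)))
    disjoint = proj₂ (proj₂ (proj₂ (proj₂ F-cycles)))

  vertex : (i : Fin k) → Fin (len i) → Fin n
  vertex = C.vertex

  vertex-injective : Injective _≡_ _≡_ (uncurry vertex)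
  vertex-injective {i , p} {i′ , p′} e with i Fin.≟ i′
  ... | no i≢i′ = ⊥-elim (disjoint i i′ i≢i′ _ (from (C.vx⇔ i _) (p , refl)) (from (C.vx⇔ i′ _) (p′ , sym e)))
  ... | yes refl = cong (i ,_) (C.vertex-injective i e)

  vertex-surjective : sumF len ≡ n → StrictlySurjective _≡_ (uncurry vertex)
  vertex-surjective = ΣFin-injective⇒surjective len (uncurry vertex) vertex-injective

  arc⇔ : ∀ u v → Arc F u v ⇔
    (∃ λ (x : ΣFin len) → u ≡ uncurry vertex x × v ≡ vertex (proj₁ x) (cycSuc (proj₂ x)))
  arc⇔ u v = mk⇔
    (λ uv → let (i , uvᵢ) = to (arcs⇔ u v) uv in Product.map (i ,_) id (to (C.arc⇔ i u v) uvᵢ))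
    (λ { ((i , p) , e) → from (arcs⇔ u v) (i , from (C.arc⇔ i u v) (p , e)) })

  outArc : ∀ u → Vx F u → ∃ λ v → Arc F u v
  outArc u u∈F =
    let (i , u∈Cᵢ) = to (proj₁ (proj₂ (proj₂ F-cycles)) u) u∈F
        (p , e) = to (C.vx⇔ i u) u∈Cᵢ
    in vertex i (cycSuc p) , from (arc⇔ u _) ((i , p) , sym e , refl)

  outArc-unique : ∀ {u v v′} → Arc F u v → Arc F u v′ → v ≡ v′
  outArc-unique {u} {v} {v′} uv uv′ with to (arc⇔ u v) uv | to (arc⇔ u v′) uv′
  ... | x , u≡x , v≡ | x′ , u≡x′ , v′≡ with vertex-injective (trans (sym u≡x) u≡x′)
  ... | refl = trans v≡ (sym v′≡)

pathFromTo-source-unique : ∀ {n p p′ x y x′ y′} {D : Digraph n} →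
  IsPathFromTo p x y D → IsPathFromTo p′ x′ y′ D → x ≡ x′
pathFromTo-source-unique (c , c-inj , c₀ , _ , vx , arc) (c′ , c′-inj , c′₀ , _ , vx′ , arc′)
  with to (vx _) (from (vx′ _) (zero , c′₀))
... | zero , e = trans (sym c₀) e
... | suc q , e with to (arc′ _ _) (from (arc _ _) (q , refl , refl))
...   | i , _ , e′ = ⊥-elim (Finₚ.0≢1+n (c′-inj (trans c′₀ (trans (sym e) e′))))

pathFromTo-target-unique : ∀ {n p p′ x y x′ y′} {D : Digraph n} →
  IsPathFromTo p x y D → IsPathFromTo p′ x′ y′ D → y ≡ y′
pathFromTo-target-unique (c , c-inj , _ , c-last , vx , arc) (c′ , c′-inj , _ , c′-last , vx′ , arc′)
  with to (vx _) (from (vx′ _) (_ , c′-last))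
... | q , e with view q
...   | ‵fromℕ = trans (sym c-last) e
...   | ‵inject₁ q′ with to (arc′ _ _) (from (arc _ _) (q′ , refl , refl))
...     | i , e′ , _ = ⊥-elim (Finₚ.fromℕ≢inject₁ (c′-inj (trans c′-last (trans (sym e) e′))))

CycleFactorisation : ∀ {k} → ℕ → (Fin k → ℕ) → Set₁
CycleFactorisation n m = Σ ℕ λ r → Σ (Fin r → Digraph n) λ F →
  Decomposition (K* n) F × (∀ q → SpanningSub (K* n) (F q) × CycleUnion m (F q))

cycleFactors↔ : ∀ {n r k} {len : Fin k → ℕ} {F : Fin r → Digraph (suc n)} →
  Decomposition (K* (suc n)) F → (∀ q → SpanningSub (K* (suc n)) (F q) × CycleUnion len (F q)) →
  Fin r ↔ Fin n
cycleFactors↔ {n} {r} {len = len} {F = F} (_ , unique) factor =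
  mk↔ₛ′ out₀ factorOf out₀∘factorOf factorOf∘out₀
  where
  -- each factor is labelled by the out-neighbour of vertex 0 in it
  arc₀ : ∀ q → ∃ λ v → Arc (F q) zero v
  arc₀ q = CycleUnionOf.outArc {len = len} {F = F q} (proj₂ (factor q)) zero (proj₂ (proj₁ (factor q)) zero zero)
  0≢arc₀ : ∀ q → zero ≢ proj₁ (arc₀ q)
  0≢arc₀ q = proj₂ (proj₁ (proj₁ (factor q))) zero _ (proj₂ (arc₀ q))
  out₀ : Fin r → Fin n
  out₀ q = punchOut (0≢arc₀ q)
  0≢punchIn : ∀ p → zero ≢ punchIn zero p
  0≢punchIn p = Finₚ.punchInᵢ≢i zero p ∘ sym
  factorOf : Fin n → Fin r
  factorOf p = proj₁ (unique zero (punchIn zero p) (0≢punchIn p))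
  out₀∘factorOf : ∀ p → out₀ (factorOf p) ≡ p
  out₀∘factorOf p = trans
    (Finₚ.punchOut-cong zero {i≢j = 0≢arc₀ (factorOf p)} {i≢k = 0≢punchIn p}
      (CycleUnionOf.outArc-unique {len = len} {F = F (factorOf p)} (proj₂ (factor (factorOf p)))
        (proj₂ (arc₀ (factorOf p)))
        (proj₁ (proj₂ (unique zero (punchIn zero p) (0≢punchIn p))))))
    (Finₚ.punchOut-punchIn zero)
  factorOf∘out₀ : ∀ q → factorOf (out₀ q) ≡ q
  factorOf∘out₀ q = sym (proj₂ (proj₂ (unique zero (punchIn zero (out₀ q)) _)) q
    (subst (Arc (F q) zero) (sym (Finₚ.punchIn-punchOut (0≢arc₀ q))) (proj₂ (arc₀ q))))

-- Assembling a 2-factor from cycles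

-- A cycle on Fin N is described by a successor function on a type of points of its own;
-- `walk` certifies that the points form a single orbit of the given length.
record CycleIn (N : ℕ) : Set₁ where
  field
    length          : ℕ
    2≤length        : 2 ≤ length
    Point           : Set
    next            : Point → Point
    walk            : Fin length → Point
    walk-cycSuc     : ∀ p → walk (cycSuc p) ≡ next (walk p)
    walk-surjective : StrictlySurjective _≡_ walk
    walk-injective  : Injective _≡_ _≡_ walk
    place           : Point → Fin N
    place-injective : Injective _≡_ _≡_ place
open CycleIn

cycleDigraph : ∀ {N} → CycleIn N → Digraph N
cycleDigraph C = record
  { Vx = λ v → ∃ λ x → place C x ≡ v
  ; Arc = λ u v → ∃ λ x → u ≡ place C x × v ≡ place C (next C x)
  ; closed = λ { (x , refl , refl) → (x , refl) , (next C x , refl) } }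

cycleDigraph-isCycle : ∀ {N} (C : CycleIn N) → IsCycle (length C) (cycleDigraph C)
cycleDigraph-isCycle C = place C ∘ walk C , walk-injective C ∘ place-injective C ,
  (λ v → mk⇔ (λ { (x , e) → let (p , walk≡) = walk-surjective C x in p , trans (cong (place C) walk≡) e })
             (λ { (p , e) → walk C p , e })) ,
  (λ u v → mk⇔ (λ { (x , refl , refl) → let (p , walk≡) = walk-surjective C x in
                      p , cong (place C) (sym walk≡) ,
                      cong (place C) (trans (cong (next C) (sym walk≡)) (sym (walk-cycSuc C p))) })
               (λ { (p , refl , refl) → walk C p , refl , cong (place C) (walk-cycSuc C p) }))

place-next-≢ : ∀ {N} (C : CycleIn N) x → place C x ≢ place C (next C x)
place-next-≢ C x e with walk-surjective C x
... | p , refl = cycSuc-≢ (2≤length C) p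
  (walk-injective C (trans (walk-cycSuc C p) (sym (place-injective C e))))

module UnionOfCycles {N k : ℕ} {I : Set} (m : Fin k → ℕ) (label : I ↔ Fin k) (cycle : I → CycleIn N)
  (length-cycle : ∀ x → length (cycle x) ≡ m (Inverse.to label x))
  (disjoint : ∀ {x y} (p : Point (cycle x)) (q : Point (cycle y)) → place (cycle x) p ≡ place (cycle y) q → x ≡ y)
  (cover : ∀ v → Σ I λ x → Σ (Point (cycle x)) λ p → place (cycle x) p ≡ v) where

  open Inverse label using () renaming (to to labelOf; from to cycleAt)

  digraph : Digraph N
  digraph = record
    { Vx = λ _ → ⊤
    ; Arc = λ u v → Σ I λ x → Σ (Point (cycle x)) λ p →
                      u ≡ place (cycle x) p × v ≡ place (cycle x) (next (cycle x) p)
    ; closed = λ _ → tt , tt }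

  component : Fin k → Digraph N
  component i = cycleDigraph (cycle (cycleAt i))

  component-cycleAt : ∀ {x v} → Vx (cycleDigraph (cycle x)) v → Vx (component (labelOf x)) v
  component-cycleAt {x} = subst (λ y → Vx (cycleDigraph (cycle y)) _) (sym (Inverse.strictlyInverseʳ label x))

  isCycleFactor : SpanningSub (K* N) digraph × CycleUnion m digraph
  isCycleFactor =
    (((λ v _ → v) , (λ { u v (x , p , refl , refl) → place-next-≢ (cycle x) p })) , (λ _ _ → tt)) ,
    component ,
    (λ i → subst (λ ℓ → IsCycle ℓ (component i))
                 (trans (length-cycle (cycleAt i)) (cong m (Inverse.strictlyInverseˡ label i)))
                 (cycleDigraph-isCycle (cycle (cycleAt i)))) ,
    (λ v → mk⇔ (λ _ → let (x , p , e) = cover v in labelOf x , component-cycleAt (p , e)) (λ _ → tt)) ,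
    (λ u v → mk⇔ (λ { (x , p , e) → labelOf x ,
                        subst (λ y → Arc (cycleDigraph (cycle y)) u v)
                              (sym (Inverse.strictlyInverseʳ label x)) (p , e) })
                 (λ { (i , p , e) → cycleAt i , p , e })) ,
    (λ i i′ i≢i′ v → λ { (p , refl) (p′ , e′) → i≢i′ (trans (sym (Inverse.strictlyInverseˡ label i))
        (trans (cong labelOf (disjoint p p′ (sym e′))) (Inverse.strictlyInverseˡ label i′))) })

embedCycle : ∀ {n N L} {D : Digraph n} → 2 ≤ L → IsCycle L D →
  (emb : Fin n → Fin N) → Injective _≡_ _≡_ emb → CycleIn N
embedCycle {L = L} 2≤L (c , c-inj , _) emb emb-inj = record
  { length = L ; 2≤length = 2≤L ; Point = Fin L ; next = cycSuc ; walk = id ; walk-cycSuc = λ _ → refl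
  ; walk-surjective = λ x → x , refl ; walk-injective = id
  ; place = emb ∘ c ; place-injective = c-inj ∘ emb-inj }

module RankedCycle {P : Set} (next : P → P) (start : P) (rank : P → ℕ) (L : ℕ)
  (rank< : ∀ x → rank x < suc L) (rank-start : rank start ≡ 0)
  (rank-next : ∀ x → suc (rank x) < suc L → rank (next x) ≡ suc (rank x))
  (next-last : ∀ x → rank x ≡ L → next x ≡ start)
  (rank-injective : Injective _≡_ _≡_ rank) where

  iterate : ℕ → P
  iterate zero = start
  iterate (suc n) = next (iterate n)

  rank-iterate : ∀ n → n < suc L → rank (iterate n) ≡ n
  rank-iterate zero _ = rank-start
  rank-iterate (suc n) lt = trans (rank-next (iterate n) (subst (λ r → suc r < suc L) (sym IH) lt)) (cong suc IH)
    where
    IH = rank-iterate n (<-trans (n<1+n n) lt)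

  walk′ : Fin (suc L) → P
  walk′ p = iterate (toℕ p)

  rank-walk : ∀ p → rank (walk′ p) ≡ toℕ p
  rank-walk p = rank-iterate (toℕ p) (toℕ<n p)

  walk-cycSuc′ : ∀ p → walk′ (cycSuc p) ≡ next (walk′ p)
  walk-cycSuc′ p with view p
  ... | ‵fromℕ = trans (cong walk′ (cycSuc-fromℕ L))
                       (sym (next-last (walk′ (fromℕ L)) (trans (rank-walk (fromℕ L)) (toℕ-fromℕ L))))
  ... | ‵inject₁ q = trans (cong walk′ (cycSuc-inject₁ q)) (cong (next ∘ iterate) (sym (toℕ-inject₁ q)))

  cycleIn : ∀ {N} → 1 ≤ L → (place : P → Fin N) → Injective _≡_ _≡_ place → CycleIn N
  cycleIn 1≤L place place-inj = record
    { length = suc L ; 2≤length = s≤s 1≤L ; Point = P ; next = next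
    ; walk = walk′ ; walk-cycSuc = walk-cycSuc′
    ; walk-surjective = λ x → fromℕ< (rank< x) , rank-injective (trans (rank-walk _) (toℕ-fromℕ< _))
    ; walk-injective = λ {p} {q} e → toℕ-injective (trans (sym (rank-walk p)) (trans (cong rank e) (rank-walk q)))
    ; place = place ; place-injective = place-inj }

-- The path x₀ → ⋯ → x_t closed up through fresh vertices as
-- x_t → α₀ → β₀ → α₁ → ⋯ → β_{σ-1} → α_σ → x₀, a cycle of length t + 2σ + 2.
data ClosedPathPoint (t σ : ℕ) : Set where
  path : Fin (suc t) → ClosedPathPoint t σ
  α    : Fin (suc σ) → ClosedPathPoint t σ
  β    : Fin σ → ClosedPathPoint t σ

module ClosedPath (t σ : ℕ) where

  step : ClosedPathPoint t σ → ClosedPathPoint t σ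
  step (path p) with view p
  ... | ‵fromℕ = α zero
  ... | ‵inject₁ q = path (suc q)
  step (α q) with view q
  ... | ‵fromℕ = path zero
  ... | ‵inject₁ q = β q
  step (β q) = α (suc q)

  step-path-inject₁ : ∀ q → step (path (inject₁ q)) ≡ path (suc q)
  step-path-inject₁ q rewrite view-inject₁ q = refl

  step-path-last : step (path (fromℕ t)) ≡ α zero
  step-path-last rewrite view-fromℕ t = refl

  rank : ClosedPathPoint t σ → ℕ
  rank (path p) = toℕ p
  rank (α q) = suc t + 2 * toℕ q
  rank (β q) = suc t + suc (2 * toℕ q)

  last : ℕ
  last = suc t + 2 * σ

  path<rank : ∀ p x → toℕ p < suc t + x
  path<rank p x = ≤-trans (toℕ<n p) (m≤m+n (suc t) x)

  rank< : ∀ x → rank x < suc last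
  rank< (path p) = ≤-trans (path<rank p _) (n≤1+n _)
  rank< (α q) = s≤s (+-monoʳ-≤ (suc t) (*-monoʳ-≤ 2 (≤-pred (toℕ<n q))))
  rank< (β q) = s≤s (+-monoʳ-≤ (suc t) (<⇒≤ (subst (_≤ 2 * σ) (*-suc 2 (toℕ q)) (*-monoʳ-≤ 2 (toℕ<n q)))))

  rank-step : ∀ x → suc (rank x) < suc last → rank (step x) ≡ suc (rank x)
  rank-step (path p) _ with view p
  ... | ‵fromℕ = trans (+-identityʳ (suc t)) (cong suc (sym (toℕ-fromℕ t)))
  ... | ‵inject₁ q = cong suc (sym (toℕ-inject₁ q))
  rank-step (α q) lt with view q
  ... | ‵fromℕ rewrite toℕ-fromℕ σ = contradiction lt (<-irrefl refl)
  ... | ‵inject₁ q rewrite toℕ-inject₁ q = +-suc (suc t) (2 * toℕ q)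
  rank-step (β q) _ = trans (cong (suc t +_) (*-suc 2 (toℕ q))) (+-suc (suc t) (suc (2 * toℕ q)))

  step-last : ∀ x → rank x ≡ last → step x ≡ path zero
  step-last (path p) e = contradiction e (<⇒≢ (path<rank p _))
  step-last (α q) e with view q
  ... | ‵fromℕ = refl
  ... | ‵inject₁ q′ = contradiction (sym (toℕ-injective q≡σ)) Finₚ.fromℕ≢inject₁
    where
    q≡σ : toℕ (inject₁ q′) ≡ toℕ (fromℕ σ)
    q≡σ = trans (*-cancelˡ-≡ _ _ 2 (+-cancelˡ-≡ (suc t) _ _ e)) (sym (toℕ-fromℕ σ))
  step-last (β q) e = contradiction (+-cancelˡ-≡ (suc t) _ _ e) (even≢odd σ (toℕ q) ∘ sym)

  rank-injective : Injective _≡_ _≡_ rank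
  rank-injective {path p} {path p′} e = cong path (toℕ-injective e)
  rank-injective {path p} {α q} e = contradiction e (<⇒≢ (path<rank p _))
  rank-injective {path p} {β q} e = contradiction e (<⇒≢ (path<rank p _))
  rank-injective {α q} {path p} e = contradiction (sym e) (<⇒≢ (path<rank p _))
  rank-injective {β q} {path p} e = contradiction (sym e) (<⇒≢ (path<rank p _))
  rank-injective {α q} {α q′} e = cong α (toℕ-injective (*-cancelˡ-≡ _ _ 2 (+-cancelˡ-≡ (suc t) _ _ e)))
  rank-injective {β q} {β q′} e =
    cong β (toℕ-injective (*-cancelˡ-≡ _ _ 2 (suc-injective (+-cancelˡ-≡ (suc t) _ _ e))))
  rank-injective {α q} {β q′} e = contradiction (+-cancelˡ-≡ (suc t) _ _ e) (even≢odd (toℕ q) (toℕ q′))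
  rank-injective {β q} {α q′} e = contradiction (+-cancelˡ-≡ (suc t) _ _ (sym e)) (even≢odd (toℕ q′) (toℕ q))

  cycle : ∀ {N} (place : ClosedPathPoint t σ → Fin N) → Injective _≡_ _≡_ place → CycleIn N
  cycle = RankedCycle.cycleIn step (path zero) rank last rank< refl rank-step step-last rank-injective (s≤s z≤n)

-- The construction

module Construction {k ℓ : ℕ} (m : Fin k → ℕ) (ℓ≤k : ℓ ≤ k) (2≤m : ∀ i → 2 ≤ m i) {s′ t′ : ℕ}
  (sum-first : sumF (firstPart ℓ≤k m) ≡ suc s′) (sum-last : sumF (lastPart ℓ≤k m) ≡ suc t′)
  {r : ℕ} (F : Fin r → Digraph (suc s′)) (F-decomposes : Decomposition (K* (suc s′)) F)
  (F-factor : ∀ q → SpanningSub (K* (suc s′)) (F q) × CycleUnion (firstPart ℓ≤k m) (F q))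
  (D′ D″ : Digraph (suc t′)) (D′D″-decomposes : Decomposition (K* (suc t′)) (pair D′ D″))
  (F′ : Fin s′ → Digraph (suc t′)) (F′-decomposes : Decomposition D′ F′)
  (F′-factor : ∀ p → SpanningSub D′ (F′ p) × CycleUnion (lastPart ℓ≤k m) (F′ p))
  (sᵢ tᵢ : Fin k → ℕ) (sum-s : sumF sᵢ ≡ suc s′) (m≡ : ∀ i → m i ≡ 2 * sᵢ i + tᵢ i)
  (H : Fin (suc t′) → Digraph (suc t′)) (H-decomposes : Decomposition D″ H)
  (ρ : Permutation′ (suc t′)) (ρ-cyclic : IsCyclicPerm ρ) (Dᵢ : Fin (suc t′) → Fin k → Digraph (suc t′))
  (condition-d : ∀ j → (∀ v → Vx (H j) v ⇔ (∃[ u ] (Vx (H zero) u × (ρ ^ toℕ j) u ≡ v))) ×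
                   DisjointUnion (H j) (Dᵢ j) ×
                   (∀ i → (tᵢ i < m i → IsPath (tᵢ i) (Dᵢ j i)) ×
                          (tᵢ i ≡ m i → IsCycle (m i) (Dᵢ j i)) ×
                          (∀ x y → IsXYPath x y (Dᵢ zero i) →
                                   IsXYPath ((ρ ^ toℕ j) x) ((ρ ^ toℕ j) y) (Dᵢ j i)))) where

  s = suc s′
  t = suc t′
  N = s + t

  left≢right : ∀ (a : Fin s) (w : Fin t) → a ↑ˡ t ≢ s ↑ʳ w
  left≢right = ↑ˡ≢↑ʳ

  left-injective : Injective _≡_ _≡_ (λ (a : Fin s) → a ↑ˡ t)
  left-injective = Finₚ.↑ˡ-injective t _ _

  right-injective : Injective _≡_ _≡_ (λ (w : Fin t) → s ↑ʳ w)
  right-injective = Finₚ.↑ʳ-injective s _ _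

  data Shape (i : Fin k) : Set where
    cyclic : sᵢ i ≡ 0 → Shape i
    split  : (σ : ℕ) → sᵢ i ≡ suc σ → Shape i

  shape : ∀ i → Shape i
  shape i with sᵢ i in e
  ... | zero = cyclic e
  ... | suc σ = split σ e

  tᵢ≡m : ∀ i → sᵢ i ≡ 0 → tᵢ i ≡ m i
  tᵢ≡m i e = sym (trans (m≡ i) (cong (λ x → 2 * x + tᵢ i) e))

  m≡closedLength : ∀ i σ → sᵢ i ≡ suc σ → m i ≡ suc (ClosedPath.last (tᵢ i) σ)
  m≡closedLength i σ e = trans (m≡ i) (trans (cong (λ x → 2 * x + tᵢ i) e)
    (+-*-Solver.solve 2 (λ σ t → con 2 :* (con 1 :+ σ) :+ t := con 1 :+ ((con 1 :+ t) :+ con 2 :* σ)) refl σ (tᵢ i)))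
    where open +-*-Solver

  tᵢ<m : ∀ i σ → sᵢ i ≡ suc σ → tᵢ i < m i
  tᵢ<m i σ e = subst (tᵢ i <_) (sym (m≡closedLength i σ e)) (s≤s (≤-trans (n≤1+n _) (m≤m+n (suc (tᵢ i)) _)))

  H-vertices : ∀ j v → Vx (H j) v ⇔ (∃[ u ] (Vx (H zero) u × (ρ ^ toℕ j) u ≡ v))
  H-vertices j = proj₁ (condition-d j)

  H-union : ∀ j → DisjointUnion (H j) (Dᵢ j)
  H-union j = proj₁ (proj₂ (condition-d j))

  D-in-H : ∀ j i v → Vx (Dᵢ j i) v → Vx (H j) v
  D-in-H j i v v∈D = from (proj₁ (H-union j) v) (i , v∈D)

  D-component : ∀ j {i i′ v} → Vx (Dᵢ j i) v → Vx (Dᵢ j i′) v → i ≡ i′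
  D-component j {i} {i′} v∈Dᵢ v∈Dᵢ′ with i Fin.≟ i′
  ... | yes i≡i′ = i≡i′
  ... | no i≢i′ = ⊥-elim (proj₂ (proj₂ (H-union j)) i i′ i≢i′ _ v∈Dᵢ v∈Dᵢ′)

  D-isCycle : ∀ j i → sᵢ i ≡ 0 → IsCycle (m i) (Dᵢ j i)
  D-isCycle j i e = proj₁ (proj₂ (proj₂ (proj₂ (condition-d j)) i)) (tᵢ≡m i e)

  D-isPath : ∀ j i σ → sᵢ i ≡ suc σ → IsPath (tᵢ i) (Dᵢ j i)
  D-isPath j i σ e = proj₁ (proj₂ (proj₂ (condition-d j)) i) (tᵢ<m i σ e)

  D-transported : ∀ j i x y → IsXYPath x y (Dᵢ zero i) → IsXYPath ((ρ ^ toℕ j) x) ((ρ ^ toℕ j) y) (Dᵢ j i)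
  D-transported j i = proj₂ (proj₂ (proj₂ (proj₂ (condition-d j)) i))

  D-pathFromTo : ∀ j i σ (e : sᵢ i ≡ suc σ) → IsPathFromTo (tᵢ i) _ _ (Dᵢ j i)
  D-pathFromTo j i σ e = proj₂ (proj₂ (D-isPath j i σ e))

  module Cycleᵢ (j : Fin t) (i : Fin k) (e : sᵢ i ≡ 0) = CycleOf {D = Dᵢ j i} (D-isCycle j i e)
  module Pathᵢ (j : Fin t) (i : Fin k) (σ : ℕ) (e : sᵢ i ≡ suc σ) = PathFromTo {D = Dᵢ j i} (D-pathFromTo j i σ e)

  -- Condition (d) transports the end vertices of the paths by ρ, but not their interiors.
  path-first : ∀ j i σ e → Pathᵢ.vertex j i σ e zero ≡ (ρ ^ toℕ j) (Pathᵢ.vertex zero i σ e zero)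
  path-first j i σ e = trans (Pathᵢ.vertex-first j i σ e)
    (trans (pathFromTo-source-unique {D = Dᵢ j i} (D-pathFromTo j i σ e)
             (proj₂ (D-transported j i _ _ (tᵢ i , D-pathFromTo zero i σ e))))
           (cong (ρ ^ toℕ j) (sym (Pathᵢ.vertex-first zero i σ e))))

  path-last : ∀ j i σ e → Pathᵢ.vertex j i σ e (fromℕ (tᵢ i)) ≡ (ρ ^ toℕ j) (Pathᵢ.vertex zero i σ e (fromℕ (tᵢ i)))
  path-last j i σ e = trans (Pathᵢ.vertex-last j i σ e)
    (trans (pathFromTo-target-unique {D = Dᵢ j i} (D-pathFromTo j i σ e)
             (proj₂ (D-transported j i _ _ (tᵢ i , D-pathFromTo zero i σ e))))
           (cong (ρ ^ toℕ j) (sym (Pathᵢ.vertex-last zero i σ e))))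

  pairing : Fin r ↔ Fin s′
  pairing = cycleFactors↔ {len = firstPart ℓ≤k m} {F = F} F-decomposes F-factor

  module SeparateFactor (q : Fin r) where
    module Fq = CycleUnionOf {len = firstPart ℓ≤k m} {F = F q} (proj₂ (F-factor q))

    pairedFactor : Fin s′
    pairedFactor = Inverse.to pairing q

    module F′q = CycleUnionOf {len = lastPart ℓ≤k m} {F = F′ pairedFactor} (proj₂ (F′-factor pairedFactor))

    cycle : Fin ℓ ⊎ Fin (k ∸ ℓ) → CycleIn N
    cycle (inj₁ i) = embedCycle {D = Fq.component i} (2≤m _) (Fq.isCycle i) (_↑ˡ t) (left-injective)
    cycle (inj₂ i) = embedCycle {D = F′q.component i} (2≤m _) (F′q.isCycle i) (s ↑ʳ_) right-injective

    length-cycle : ∀ x → length (cycle x) ≡ m (Inverse.to (firstLast↔ ℓ≤k) x)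
    length-cycle (inj₁ i) = cong m (sym (firstLast↔-first ℓ≤k i))
    length-cycle (inj₂ i) = refl

    disjoint : ∀ {x y} p p′ → place (cycle x) p ≡ place (cycle y) p′ → x ≡ y
    disjoint {inj₁ i} {inj₁ i′} p p′ e = cong (inj₁ ∘ proj₁) (Fq.vertex-injective (left-injective e))
    disjoint {inj₁ i} {inj₂ i′} p p′ e = ⊥-elim (left≢right _ _ e)
    disjoint {inj₂ i} {inj₁ i′} p p′ e = ⊥-elim (left≢right _ _ (sym e))
    disjoint {inj₂ i} {inj₂ i′} p p′ e = cong (inj₂ ∘ proj₁) (F′q.vertex-injective (right-injective e))

    cover : ∀ v → Σ _ λ x → Σ (Point (cycle x)) λ p → place (cycle x) p ≡ v
    cover v with side {s} {t} v
    ... | left a = let ((i , p) , e) = Fq.vertex-surjective sum-first a in inj₁ i , p , cong (_↑ˡ t) e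
    ... | right w = let ((i , p) , e) = F′q.vertex-surjective sum-last w in inj₂ i , p , cong (s ↑ʳ_) e

    open UnionOfCycles m (firstLast↔ ℓ≤k) cycle length-cycle disjoint cover public

    arc-left⇔ : ∀ (a a′ : Fin s) → Arc digraph (a ↑ˡ t) (a′ ↑ˡ t) ⇔ Arc (F q) a a′
    arc-left⇔ a a′ = mk⇔ forth back
      where
      forth : Arc digraph (a ↑ˡ t) (a′ ↑ˡ t) → Arc (F q) a a′
      forth (inj₁ i , p , e , e′) = from (Fq.arc⇔ a a′) ((i , p) , left-injective e , left-injective e′)
      forth (inj₂ i , p , e , _) = ⊥-elim (left≢right _ _ e)
      back : Arc (F q) a a′ → Arc digraph (a ↑ˡ t) (a′ ↑ˡ t)
      back aa′ = let ((i , p) , e , e′) = to (Fq.arc⇔ a a′) aa′ in inj₁ i , p , cong (_↑ˡ t) e , cong (_↑ˡ t) e′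

    arc-right⇔ : ∀ w w′ → Arc digraph (s ↑ʳ w) (s ↑ʳ w′) ⇔ Arc (F′ pairedFactor) w w′
    arc-right⇔ w w′ = mk⇔ forth back
      where
      forth : Arc digraph (s ↑ʳ w) (s ↑ʳ w′) → Arc (F′ pairedFactor) w w′
      forth (inj₂ i , p , e , e′) = from (F′q.arc⇔ w w′) ((i , p) , right-injective e , right-injective e′)
      forth (inj₁ i , p , e , _) = ⊥-elim (left≢right _ _ (sym e))
      back : Arc (F′ pairedFactor) w w′ → Arc digraph (s ↑ʳ w) (s ↑ʳ w′)
      back ww′ = let ((i , p) , e , e′) = to (F′q.arc⇔ w w′) ww′ in inj₂ i , p , cong (s ↑ʳ_) e , cong (s ↑ʳ_) e′

    no-arc-left-right : ∀ (a : Fin s) w → ¬ Arc digraph (a ↑ˡ t) (s ↑ʳ w)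
    no-arc-left-right a w (inj₁ i , p , _ , e′) = left≢right _ _ (sym e′)
    no-arc-left-right a w (inj₂ i , p , e , _) = left≢right _ _ e

    no-arc-right-left : ∀ (a : Fin s) w → ¬ Arc digraph (s ↑ʳ w) (a ↑ˡ t)
    no-arc-right-left a w (inj₁ i , p , e , _) = left≢right _ _ (sym e)
    no-arc-right-left a w (inj₂ i , p , _ , e′) = left≢right _ _ e′

  αVertex : ΣFin sᵢ → Fin s
  αVertex = cast sum-s ∘ fromΣ sᵢ

  αIndex : Fin s → ΣFin sᵢ
  αIndex = toΣ sᵢ ∘ cast (sym sum-s)

  αVertex-αIndex : ∀ a → αVertex (αIndex a) ≡ a
  αVertex-αIndex a = trans (cong (cast sum-s) (fromΣ-toΣ sᵢ _)) (cast-involutive sum-s (sym sum-s) a)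

  αIndex-αVertex : ∀ x → αIndex (αVertex x) ≡ x
  αIndex-αVertex x = trans (cong (toΣ sᵢ) (cast-involutive (sym sum-s) sum-s _)) (toΣ-fromΣ sᵢ x)

  αVertex-injective : Injective _≡_ _≡_ αVertex
  αVertex-injective {x} {y} e = trans (sym (αIndex-αVertex x)) (trans (cong αIndex e) (αIndex-αVertex y))

  vertexCount : ∀ i → Shape i → ℕ
  vertexCount i (cyclic _) = m i
  vertexCount i (split σ _) = suc (tᵢ i)

  vertexOf : ∀ i (sh : Shape i) → Fin (vertexCount i sh) → Fin t
  vertexOf i (cyclic e) = Cycleᵢ.vertex zero i e
  vertexOf i (split σ e) = Pathᵢ.vertex zero i σ e

  vertexOf-injective : ∀ i sh → Injective _≡_ _≡_ (vertexOf i sh)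
  vertexOf-injective i (cyclic e) = Cycleᵢ.vertex-injective zero i e
  vertexOf-injective i (split σ e) = Pathᵢ.vertex-injective zero i σ e

  vertexOf-vx⇔ : ∀ i sh v → Vx (Dᵢ zero i) v ⇔ (∃ λ p → vertexOf i sh p ≡ v)
  vertexOf-vx⇔ i (cyclic e) = Cycleᵢ.vx⇔ zero i e
  vertexOf-vx⇔ i (split σ e) = Pathᵢ.vx⇔ zero i σ e

  H₀-count : Fin k → ℕ
  H₀-count i = vertexCount i (shape i)

  H₀-vertexΣ : ΣFin H₀-count → Fin t
  H₀-vertexΣ = uncurry (λ i → vertexOf i (shape i))

  H₀-vertex : Fin (sumF H₀-count) → Fin t
  H₀-vertex = H₀-vertexΣ ∘ toΣ H₀-count

  H₀-vertexΣ-injective : Injective _≡_ _≡_ H₀-vertexΣ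
  H₀-vertexΣ-injective {i , p} {i′ , p′} e
    with D-component zero (from (vertexOf-vx⇔ i (shape i) _) (p , refl)) (from (vertexOf-vx⇔ i′ (shape i′) _) (p′ , sym e))
  ... | refl = cong (i ,_) (vertexOf-injective i (shape i) e)

  H₀-vertex-injective : Injective _≡_ _≡_ H₀-vertex
  H₀-vertex-injective {z} {z′} e =
    trans (sym (fromΣ-toΣ H₀-count z)) (trans (cong (fromΣ H₀-count) (H₀-vertexΣ-injective e)) (fromΣ-toΣ H₀-count z′))

  H₀-vertex-vx⇔ : ∀ v → Vx (H zero) v ⇔ (∃ λ z → H₀-vertex z ≡ v)
  H₀-vertex-vx⇔ v = mk⇔
    (λ v∈H₀ → let (i , v∈D) = to (proj₁ (H-union zero) v) v∈H₀
                  (p , e) = to (vertexOf-vx⇔ i (shape i) v) v∈D in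
      fromΣ H₀-count (i , p) , trans (cong H₀-vertexΣ (toΣ-fromΣ H₀-count (i , p))) e)
    (λ { (z , e) → D-in-H zero _ v (from (vertexOf-vx⇔ _ (shape _) v) (_ , e)) })

  NotInH₀ : Fin t → Set
  NotInH₀ v = ¬ (∃ λ z → H₀-vertex z ≡ v)

  inH₀? : ∀ v → Dec (∃ λ z → H₀-vertex z ≡ v)
  inH₀? v = any? (λ z → H₀-vertex z Fin.≟ v)

  abstract
    outsideH₀ : Enumeration NotInH₀
    outsideH₀ = enumerate (λ v → ¬? (inH₀? v))

  open Enumeration outsideH₀ using (size; elem; elem-injective; elem-∈; elem-complete)

  H₀-count+size : sumF H₀-count + size ≡ t
  H₀-count+size = disjoint-cover-sizes H₀-vertex elem H₀-vertex-injective elem-injective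
    (λ z y e → elem-∈ y (z , e)) cover
    where
    cover : ∀ v → (∃ λ z → H₀-vertex z ≡ v) ⊎ (∃ λ y → elem y ≡ v)
    cover v with inH₀? v
    ... | yes v∈H₀ = inj₁ v∈H₀
    ... | no v∉H₀ = inj₂ (elem-complete v v∉H₀)

  βCount : Fin k → ℕ
  βCount i = sᵢ i ∸ 1

  H₀-count+βCount : ∀ i → H₀-count i + βCount i ≡ tᵢ i + sᵢ i
  H₀-count+βCount i with shape i
  ... | cyclic e rewrite e = cong (_+ 0) (sym (tᵢ≡m i e))
  ... | split σ e rewrite e = sym (+-suc (tᵢ i) σ)

  sum-t+s : sumF tᵢ + sumF sᵢ ≡ t
  sum-t+s = +-cancelˡ-≡ s _ _ (begin
    s + (sumF tᵢ + sumF sᵢ)        ≡⟨ cong (_+ (sumF tᵢ + sumF sᵢ)) (sym sum-s) ⟩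
    sumF sᵢ + (sumF tᵢ + sumF sᵢ)  ≡⟨ cong (sumF sᵢ +_) (sym (sumF-distrib-+ tᵢ sᵢ)) ⟩
    sumF sᵢ + sumF (λ i → tᵢ i + sᵢ i) ≡⟨ sym (sumF-distrib-+ sᵢ _) ⟩
    sumF (λ i → sᵢ i + (tᵢ i + sᵢ i))  ≡⟨ sym (sumF-cong m≡s+t+s) ⟩
    sumF m                         ≡⟨ sumF-firstPart-lastPart ℓ≤k m ⟩
    sumF (firstPart ℓ≤k m) + sumF (lastPart ℓ≤k m) ≡⟨ cong₂ _+_ sum-first sum-last ⟩
    s + t                          ∎)
    where
    open ≡-Reasoning
    m≡s+t+s : ∀ i → m i ≡ sᵢ i + (tᵢ i + sᵢ i)
    m≡s+t+s i = trans (m≡ i) (+-*-Solver.solve 2 (λ x y → con 2 :* x :+ y := x :+ (y :+ x)) refl (sᵢ i) (tᵢ i))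
      where open +-*-Solver

  sum-βCount : sumF βCount ≡ size
  sum-βCount = +-cancelˡ-≡ (sumF H₀-count) _ _ (begin
    sumF H₀-count + sumF βCount         ≡⟨ sym (sumF-distrib-+ H₀-count βCount) ⟩
    sumF (λ i → H₀-count i + βCount i)  ≡⟨ sumF-cong H₀-count+βCount ⟩
    sumF (λ i → tᵢ i + sᵢ i)            ≡⟨ sumF-distrib-+ tᵢ sᵢ ⟩
    sumF tᵢ + sumF sᵢ                   ≡⟨ sum-t+s ⟩
    t                                   ≡⟨ sym H₀-count+size ⟩
    sumF H₀-count + size                ∎)
    where open ≡-Reasoning

  βVertex : ΣFin βCount → Fin t
  βVertex = elem ∘ cast sum-βCount ∘ fromΣ βCount

  βVertex-injective : Injective _≡_ _≡_ βVertex
  βVertex-injective = fromΣ-injective βCount ∘ cast-injective sum-βCount ∘ elem-injective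

  βIndex : ∀ y → ∃ λ x → βVertex x ≡ elem y
  βIndex y = toΣ βCount (cast (sym sum-βCount) y) ,
    cong elem (trans (cong (cast sum-βCount) (fromΣ-toΣ βCount _)) (cast-involutive sum-βCount (sym sum-βCount) y))

  ρβVertex∉H : ∀ j x v → Vx (H j) v → (ρ ^ toℕ j) (βVertex x) ≢ v
  ρβVertex∉H j x v v∈Hⱼ ρb≡v with to (H-vertices j v) v∈Hⱼ
  ... | u , u∈H₀ , ρu≡v = elem-∈ _ (to (H₀-vertex-vx⇔ (βVertex x))
    (subst (Vx (H zero)) (^-injective ρ (toℕ j) (trans ρu≡v (sym ρb≡v))) u∈H₀))

  αAt : ∀ i σ → sᵢ i ≡ suc σ → Fin (suc σ) → ΣFin sᵢ
  αAt i σ e q = i , cast (sym e) q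

  βAt : ∀ i σ → sᵢ i ≡ suc σ → Fin σ → ΣFin βCount
  βAt i σ e q = i , cast (cong (_∸ 1) (sym e)) q

  closedOut : ∀ i σ (e : sᵢ i ≡ suc σ) → Fin (suc σ) → Fin t
  closedOut i σ e q with view q
  ... | ‵fromℕ = Pathᵢ.vertex zero i σ e zero
  ... | ‵inject₁ q′ = βVertex (βAt i σ e q′)

  closedIn : ∀ i σ (e : sᵢ i ≡ suc σ) → Fin (suc σ) → Fin t
  closedIn i σ e zero = Pathᵢ.vertex zero i σ e (fromℕ (tᵢ i))
  closedIn i σ e (suc q) = βVertex (βAt i σ e q)

  -- In the j-th factor the vertex αVertex (i , q) has out-neighbour ρ^j (outAnchor i _ q)
  -- and in-neighbour ρ^j (inAnchor i _ q).
  outAnchor inAnchor : ∀ i → Shape i → Fin (sᵢ i) → Fin t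
  outAnchor i (cyclic e) q = ⊥-elim (Finₚ.¬Fin0 (subst Fin e q))
  outAnchor i (split σ e) q = closedOut i σ e (cast e q)
  inAnchor i (cyclic e) q = ⊥-elim (Finₚ.¬Fin0 (subst Fin e q))
  inAnchor i (split σ e) q = closedIn i σ e (cast e q)

  outNeighbour inNeighbour : Fin s → Fin t
  outNeighbour = uncurry (λ i → outAnchor i (shape i)) ∘ αIndex
  inNeighbour = uncurry (λ i → inAnchor i (shape i)) ∘ αIndex

  module RotatedFactor (j : Fin t) where
    ρʲ : Fin t → Fin t
    ρʲ = ρ ^ toℕ j

    closedPlace : ∀ i σ (e : sᵢ i ≡ suc σ) → ClosedPathPoint (tᵢ i) σ → Fin N
    closedPlace i σ e (path p) = s ↑ʳ Pathᵢ.vertex j i σ e p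
    closedPlace i σ e (α q) = αVertex (αAt i σ e q) ↑ˡ t
    closedPlace i σ e (β q) = s ↑ʳ ρʲ (βVertex (βAt i σ e q))

    path≢ρβ : ∀ i σ e p x → Pathᵢ.vertex j i σ e p ≢ ρʲ (βVertex x)
    path≢ρβ i σ e p x v≡ρb = ρβVertex∉H j x _ (D-in-H j i _ (from (Pathᵢ.vx⇔ j i σ e _) (p , refl))) (sym v≡ρb)

    closedPlace-injective : ∀ i σ e → Injective _≡_ _≡_ (closedPlace i σ e)
    closedPlace-injective i σ e {path p} {path p′} x = cong path (Pathᵢ.vertex-injective j i σ e (right-injective x))
    closedPlace-injective i σ e {path p} {α q} x = ⊥-elim (left≢right _ _ (sym x))
    closedPlace-injective i σ e {path p} {β q} x = ⊥-elim (path≢ρβ i σ e p _ (right-injective x))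
    closedPlace-injective i σ e {α q} {path p} x = ⊥-elim (left≢right _ _ x)
    closedPlace-injective i σ e {α q} {α q′} x =
      cong α (cast-injective (sym e) (ΣFin-,-injectiveʳ (αVertex-injective (left-injective x))))
    closedPlace-injective i σ e {α q} {β q′} x = ⊥-elim (left≢right _ _ x)
    closedPlace-injective i σ e {β q} {path p} x = ⊥-elim (path≢ρβ i σ e p _ (sym (right-injective x)))
    closedPlace-injective i σ e {β q} {α q′} x = ⊥-elim (left≢right _ _ (sym x))
    closedPlace-injective i σ e {β q} {β q′} x = cong β (cast-injective (cong (_∸ 1) (sym e))
      (ΣFin-,-injectiveʳ (βVertex-injective (^-injective ρ (toℕ j) (right-injective x)))))

    cycle : ∀ i → Shape i → CycleIn N
    cycle i (cyclic e) = embedCycle {D = Dᵢ j i} (2≤m i) (D-isCycle j i e) (s ↑ʳ_) right-injective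
    cycle i (split σ e) = ClosedPath.cycle (tᵢ i) σ (closedPlace i σ e) (closedPlace-injective i σ e)

    length-cycle : ∀ i sh → length (cycle i sh) ≡ m i
    length-cycle i (cyclic e) = refl
    length-cycle i (split σ e) = sym (m≡closedLength i σ e)

    data VertexKind (i : Fin k) (v : Fin N) : Set where
      α-kind : ∀ q → v ≡ αVertex (i , q) ↑ˡ t → VertexKind i v
      D-kind : ∀ w → v ≡ s ↑ʳ w → Vx (Dᵢ j i) w → VertexKind i v
      β-kind : ∀ q → v ≡ s ↑ʳ ρʲ (βVertex (i , q)) → VertexKind i v

    kind : ∀ i sh x → VertexKind i (place (cycle i sh) x)
    kind i (cyclic e) p = D-kind _ refl (from (Cycleᵢ.vx⇔ j i e _) (p , refl))
    kind i (split σ e) (path p) = D-kind _ refl (from (Pathᵢ.vx⇔ j i σ e _) (p , refl))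
    kind i (split σ e) (α q) = α-kind _ refl
    kind i (split σ e) (β q) = β-kind _ refl

    kind-unique : ∀ {i i′ v} → VertexKind i v → VertexKind i′ v → i ≡ i′
    kind-unique (α-kind q refl) (α-kind q′ x) = cong proj₁ (αVertex-injective (left-injective x))
    kind-unique (α-kind q refl) (D-kind w x _) = ⊥-elim (left≢right _ _ x)
    kind-unique (α-kind q refl) (β-kind q′ x) = ⊥-elim (left≢right _ _ x)
    kind-unique (D-kind w refl _) (α-kind q x) = ⊥-elim (left≢right _ _ (sym x))
    kind-unique (D-kind w refl w∈D) (D-kind w′ x w′∈D) =
      D-component j w∈D (subst (Vx (Dᵢ j _)) (sym (right-injective x)) w′∈D)
    kind-unique (D-kind w refl w∈D) (β-kind q x) =
      ⊥-elim (ρβVertex∉H j _ w (D-in-H j _ w w∈D) (sym (right-injective x)))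
    kind-unique (β-kind q refl) (α-kind q′ x) = ⊥-elim (left≢right _ _ (sym x))
    kind-unique (β-kind q refl) (D-kind w x w∈D) =
      ⊥-elim (ρβVertex∉H j _ w (D-in-H j _ w w∈D) (right-injective x))
    kind-unique (β-kind q refl) (β-kind q′ x) =
      cong proj₁ (βVertex-injective (^-injective ρ (toℕ j) (right-injective x)))

    disjoint : ∀ {i i′} p p′ → place (cycle i (shape i)) p ≡ place (cycle i′ (shape i′)) p′ → i ≡ i′
    disjoint {i} {i′} p p′ x = kind-unique (kind i (shape i) p) (subst (VertexKind i′) (sym x) (kind i′ (shape i′) p′))

    Placed : Fin k → Fin N → Set
    Placed i v = Σ (Point (cycle i (shape i))) λ x → place (cycle i (shape i)) x ≡ v

    placed-α : ∀ i sh (q : Fin (sᵢ i)) → Σ (Point (cycle i sh)) λ x → place (cycle i sh) x ≡ αVertex (i , q) ↑ˡ t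
    placed-α i (cyclic e) q = ⊥-elim (Finₚ.¬Fin0 (subst Fin e q))
    placed-α i (split σ e) q = α (cast e q) , cong (λ z → αVertex (i , z) ↑ˡ t) (cast-involutive (sym e) e q)

    placed-D : ∀ i sh w → Vx (Dᵢ j i) w → Σ (Point (cycle i sh)) λ x → place (cycle i sh) x ≡ s ↑ʳ w
    placed-D i (cyclic e) w w∈D = Product.map id (cong (s ↑ʳ_)) (to (Cycleᵢ.vx⇔ j i e w) w∈D)
    placed-D i (split σ e) w w∈D = Product.map path (cong (s ↑ʳ_)) (to (Pathᵢ.vx⇔ j i σ e w) w∈D)

    placed-β : ∀ i sh (q : Fin (βCount i)) → Σ (Point (cycle i sh)) λ x → place (cycle i sh) x ≡ s ↑ʳ ρʲ (βVertex (i , q))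
    placed-β i (cyclic e) q = ⊥-elim (Finₚ.¬Fin0 (subst (λ n → Fin (n ∸ 1)) e q))
    placed-β i (split σ e) q = β (cast (cong (_∸ 1) e) q) ,
      cong (λ z → s ↑ʳ ρʲ (βVertex (i , z))) (cast-involutive (cong (_∸ 1) (sym e)) (cong (_∸ 1) e) q)

    -- ρʲ u lies on a path or cycle of H_j if u ∈ V(H₀), and is a β-vertex otherwise
    cover-right : ∀ u → ∃ λ i → Placed i (s ↑ʳ ρʲ u)
    cover-right u with inH₀? u
    ... | yes u∈H₀ =
      let ρu∈H = from (H-vertices j (ρʲ u)) (u , from (H₀-vertex-vx⇔ u) u∈H₀ , refl)
          (i , ρu∈D) = to (proj₁ (H-union j) (ρʲ u)) ρu∈H
      in i , placed-D i (shape i) _ ρu∈D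
    ... | no u∉H₀ =
      let (y , elem≡u) = elem-complete u u∉H₀
          ((i , q) , β≡elem) = βIndex y
      in i , subst (λ z → Placed i (s ↑ʳ ρʲ z)) (trans β≡elem elem≡u) (placed-β i (shape i) q)

    cover : ∀ v → ∃ λ i → Placed i v
    cover v with side {s} {t} v
    ... | left a = let (i , q) = αIndex a in
      i , subst (λ z → Placed i (z ↑ˡ t)) (αVertex-αIndex a) (placed-α i (shape i) q)
    ... | right w = let (u , ρu≡w) = injective⇒surjective (^-injective ρ (toℕ j)) w in
      subst (λ z → ∃ λ i → Placed i (s ↑ʳ z)) ρu≡w (cover-right u)

    open UnionOfCycles m ↔-refl (λ i → cycle i (shape i)) (λ i → length-cycle i (shape i)) disjoint cover public

    data ArcKind (i : Fin k) (sh : Shape i) (u v : Fin N) : Set where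
      inside   : ∀ w w′ → u ≡ s ↑ʳ w → v ≡ s ↑ʳ w′ → Arc (Dᵢ j i) w w′ → ArcKind i sh u v
      leaving  : ∀ q → u ≡ αVertex (i , q) ↑ˡ t → v ≡ s ↑ʳ ρʲ (outAnchor i sh q) → ArcKind i sh u v
      entering : ∀ q → u ≡ s ↑ʳ ρʲ (inAnchor i sh q) → v ≡ αVertex (i , q) ↑ˡ t → ArcKind i sh u v

    place-step-α : ∀ i σ e q →
      closedPlace i σ e (ClosedPath.step (tᵢ i) σ (α q)) ≡ s ↑ʳ ρʲ (closedOut i σ e q)
    place-step-α i σ e q with view q
    ... | ‵fromℕ = cong (s ↑ʳ_) (path-first j i σ e)
    ... | ‵inject₁ q′ = refl

    arcKind : ∀ i sh x → ArcKind i sh (place (cycle i sh) x) (place (cycle i sh) (next (cycle i sh) x))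
    arcKind i (cyclic e) p = inside _ _ refl refl (from (Cycleᵢ.arc⇔ j i e _ _) (p , refl , refl))
    arcKind i (split σ e) (path p) with view p
    ... | ‵fromℕ = entering (cast (sym e) zero)
      (cong (s ↑ʳ_) (trans (path-last j i σ e) (cong (ρʲ ∘ closedIn i σ e) (sym (cast-involutive e (sym e) zero)))))
      refl
    ... | ‵inject₁ q = inside _ _ refl refl (from (Pathᵢ.arc⇔ j i σ e _ _) (q , refl , refl))
    arcKind i (split σ e) (α q) = leaving (cast (sym e) q) refl
      (trans (place-step-α i σ e q)
             (cong (λ z → s ↑ʳ ρʲ (closedOut i σ e z)) (sym (cast-involutive e (sym e) q))))
    arcKind i (split σ e) (β q) = entering (cast (sym e) (suc q))
      (cong (λ z → s ↑ʳ ρʲ (closedIn i σ e z)) (sym (cast-involutive e (sym e) (suc q)))) refl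

    arcKindOf : ∀ {u v} → Arc digraph u v → ∃ λ i → ArcKind i (shape i) u v
    arcKindOf (i , x , refl , refl) = i , arcKind i (shape i) x

    outNeighbour-αVertex : ∀ {i q a} → a ≡ αVertex (i , q) → outNeighbour a ≡ outAnchor i (shape i) q
    outNeighbour-αVertex refl = cong (uncurry (λ i → outAnchor i (shape i))) (αIndex-αVertex _)

    inNeighbour-αVertex : ∀ {i q a} → a ≡ αVertex (i , q) → inNeighbour a ≡ inAnchor i (shape i) q
    inNeighbour-αVertex refl = cong (uncurry (λ i → inAnchor i (shape i))) (αIndex-αVertex _)

    no-arc-left-left : ∀ (a a′ : Fin s) → ¬ Arc digraph (a ↑ˡ t) (a′ ↑ˡ t)
    no-arc-left-left a a′ aa′ with arcKindOf aa′
    ... | _ , inside _ _ x _ _ = left≢right _ _ x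
    ... | _ , leaving _ _ x = left≢right _ _ x
    ... | _ , entering _ x _ = left≢right _ _ x

    arc-left-right : ∀ (a : Fin s) w → Arc digraph (a ↑ˡ t) (s ↑ʳ w) → ρʲ (outNeighbour a) ≡ w
    arc-left-right a w aw with arcKindOf aw
    ... | _ , inside _ _ x _ _ = ⊥-elim (left≢right _ _ x)
    ... | _ , leaving q x x′ = trans (cong ρʲ (outNeighbour-αVertex (left-injective x)))
                                     (sym (right-injective x′))
    ... | _ , entering _ x _ = ⊥-elim (left≢right _ _ x)

    arc-right-left : ∀ (a : Fin s) w → Arc digraph (s ↑ʳ w) (a ↑ˡ t) → ρʲ (inNeighbour a) ≡ w
    arc-right-left a w wa with arcKindOf wa
    ... | _ , inside _ _ _ x _ = ⊥-elim (left≢right _ _ x)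
    ... | _ , leaving _ x _ = ⊥-elim (left≢right _ _ (sym x))
    ... | _ , entering q x x′ = trans (cong ρʲ (inNeighbour-αVertex (left-injective x′)))
                                      (sym (right-injective x))

    arc-right-right : ∀ w w′ → Arc digraph (s ↑ʳ w) (s ↑ʳ w′) → Arc (H j) w w′
    arc-right-right w w′ ww′ with arcKindOf ww′
    ... | i , inside _ _ x x′ arc = from (proj₁ (proj₂ (H-union j)) w w′)
      (i , subst₂ (Arc (Dᵢ j i)) (sym (right-injective x)) (sym (right-injective x′)) arc)
    ... | _ , leaving _ x _ = ⊥-elim (left≢right _ _ (sym x))
    ... | _ , entering _ _ x = ⊥-elim (left≢right _ _ (sym x))

    ArcOn : ∀ i → Shape i → Fin N → Fin N → Set
    ArcOn i sh u v = Σ (Point (cycle i sh)) λ x → place (cycle i sh) x ≡ u × place (cycle i sh) (next (cycle i sh) x) ≡ v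

    arcOn-leaving : ∀ i sh q → ArcOn i sh (αVertex (i , q) ↑ˡ t) (s ↑ʳ ρʲ (outAnchor i sh q))
    arcOn-leaving i (cyclic e) q = ⊥-elim (Finₚ.¬Fin0 (subst Fin e q))
    arcOn-leaving i (split σ e) q =
      α (cast e q) , cong (λ z → αVertex (i , z) ↑ˡ t) (cast-involutive (sym e) e q) , place-step-α i σ e (cast e q)

    arcOn-entering : ∀ i sh q → ArcOn i sh (s ↑ʳ ρʲ (inAnchor i sh q)) (αVertex (i , q) ↑ˡ t)
    arcOn-entering i (cyclic e) q = ⊥-elim (Finₚ.¬Fin0 (subst Fin e q))
    arcOn-entering i (split σ e) q =
      subst (λ z → ArcOn i (split σ e) (s ↑ʳ ρʲ (closedIn i σ e (cast e q))) (αVertex (i , z) ↑ˡ t))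
            (cast-involutive (sym e) e q) (entering′ (cast e q))
      where
      entering′ : ∀ q′ → ArcOn i (split σ e) (s ↑ʳ ρʲ (closedIn i σ e q′)) (αVertex (αAt i σ e q′) ↑ˡ t)
      entering′ zero = path (fromℕ (tᵢ i)) , cong (s ↑ʳ_) (path-last j i σ e) ,
        cong (closedPlace i σ e) (ClosedPath.step-path-last (tᵢ i) σ)
      entering′ (suc q′) = β q′ , refl , refl

    arcOn-inside : ∀ i sh w w′ → Arc (Dᵢ j i) w w′ → ArcOn i sh (s ↑ʳ w) (s ↑ʳ w′)
    arcOn-inside i (cyclic e) w w′ ww′ =
      let (p , w≡ , w′≡) = to (Cycleᵢ.arc⇔ j i e w w′) ww′ in p , cong (s ↑ʳ_) (sym w≡) , cong (s ↑ʳ_) (sym w′≡)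
    arcOn-inside i (split σ e) w w′ ww′ =
      let (q , w≡ , w′≡) = to (Pathᵢ.arc⇔ j i σ e w w′) ww′ in
      path (inject₁ q) , cong (s ↑ʳ_) (sym w≡) ,
      trans (cong (closedPlace i σ e) (ClosedPath.step-path-inject₁ (tᵢ i) σ q)) (cong (s ↑ʳ_) (sym w′≡))

    arc : ∀ {i u v} → ArcOn i (shape i) u v → Arc digraph u v
    arc {i} (x , e , e′) = i , x , sym e , sym e′

    arc-out : ∀ (a : Fin s) → Arc digraph (a ↑ˡ t) (s ↑ʳ ρʲ (outNeighbour a))
    arc-out a = let (i , q) = αIndex a in
      subst (λ z → Arc digraph (z ↑ˡ t) (s ↑ʳ ρʲ (outNeighbour a))) (αVertex-αIndex a)
            (arc (arcOn-leaving i (shape i) q))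

    arc-in : ∀ (a : Fin s) → Arc digraph (s ↑ʳ ρʲ (inNeighbour a)) (a ↑ˡ t)
    arc-in a = let (i , q) = αIndex a in
      subst (λ z → Arc digraph (s ↑ʳ ρʲ (inNeighbour a)) (z ↑ˡ t)) (αVertex-αIndex a)
            (arc (arcOn-entering i (shape i) q))

    arc-H : ∀ w w′ → Arc (H j) w w′ → Arc digraph (s ↑ʳ w) (s ↑ʳ w′)
    arc-H w w′ ww′ =
      let (i , ww′ᵢ) = to (proj₁ (proj₂ (H-union j)) w w′) ww′ in arc (arcOn-inside i (shape i) w w′ ww′ᵢ)

  Factor : Fin r ⊎ Fin t → Digraph N
  Factor (inj₁ q) = SeparateFactor.digraph q
  Factor (inj₂ j) = RotatedFactor.digraph j

  UniqueFactor : Fin N → Fin N → Set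
  UniqueFactor u v = Σ (Fin r ⊎ Fin t) λ z → Arc (Factor z) u v × (∀ z′ → Arc (Factor z′) u v → z′ ≡ z)

  unique-left-left : ∀ a a′ → a ≢ a′ → UniqueFactor (a ↑ˡ t) (a′ ↑ˡ t)
  unique-left-left a a′ a≢a′ with proj₂ F-decomposes a a′ a≢a′
  ... | q , aa′ , only = inj₁ q , from (SeparateFactor.arc-left⇔ q a a′) aa′ , λ
    { (inj₁ q′) arc → cong inj₁ (only q′ (to (SeparateFactor.arc-left⇔ q′ a a′) arc))
    ; (inj₂ j) arc → ⊥-elim (RotatedFactor.no-arc-left-left j a a′ arc) }

  -- the arcs from a to T are spread over the rotated factors by the orbit of ρ
  unique-left-right : ∀ a w → UniqueFactor (a ↑ˡ t) (s ↑ʳ w)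
  unique-left-right a w with orbit-surjective ρ-cyclic (outNeighbour a) w
  ... | j , ρʲout≡w =
    inj₂ j ,
    subst (λ z → Arc (RotatedFactor.digraph j) (a ↑ˡ t) (s ↑ʳ z)) ρʲout≡w (RotatedFactor.arc-out j a) , λ
    { (inj₁ q) arc → ⊥-elim (SeparateFactor.no-arc-left-right q a w arc)
    ; (inj₂ j′) arc → cong inj₂ (orbit-injective ρ-cyclic (outNeighbour a)
                                  (trans (RotatedFactor.arc-left-right j′ a w arc) (sym ρʲout≡w))) }

  unique-right-left : ∀ a w → UniqueFactor (s ↑ʳ w) (a ↑ˡ t)
  unique-right-left a w with orbit-surjective ρ-cyclic (inNeighbour a) w
  ... | j , ρʲin≡w =
    inj₂ j ,
    subst (λ z → Arc (RotatedFactor.digraph j) (s ↑ʳ z) (a ↑ˡ t)) ρʲin≡w (RotatedFactor.arc-in j a) , λ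
    { (inj₁ q) arc → ⊥-elim (SeparateFactor.no-arc-right-left q a w arc)
    ; (inj₂ j′) arc → cong inj₂ (orbit-injective ρ-cyclic (inNeighbour a)
                                  (trans (RotatedFactor.arc-right-left j′ a w arc) (sym ρʲin≡w))) }

  arc-D′ : ∀ q w w′ → Arc (SeparateFactor.digraph q) (s ↑ʳ w) (s ↑ʳ w′) → Arc D′ w w′
  arc-D′ q w w′ arc =
    proj₂ (proj₁ F′-decomposes (SeparateFactor.pairedFactor q)) w w′ (to (SeparateFactor.arc-right⇔ q w w′) arc)

  arc-D″ : ∀ j w w′ → Arc (RotatedFactor.digraph j) (s ↑ʳ w) (s ↑ʳ w′) → Arc D″ w w′
  arc-D″ j w w′ arc = proj₂ (proj₁ H-decomposes j) w w′ (RotatedFactor.arc-right-right j w w′ arc)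

  unique-right-right : ∀ w w′ → w ≢ w′ → UniqueFactor (s ↑ʳ w) (s ↑ʳ w′)
  unique-right-right w w′ w≢w′ with proj₂ D′D″-decomposes w w′ w≢w′
  ... | zero , ww′∈D′ , onlyD′ = viaD′ (proj₂ F′-decomposes w w′ ww′∈D′)
    where
    viaD′ : (Σ (Fin s′) λ p → Arc (F′ p) w w′ × (∀ p′ → Arc (F′ p′) w w′ → p′ ≡ p)) → UniqueFactor (s ↑ʳ w) (s ↑ʳ w′)
    viaD′ (p , ww′ , only) = inj₁ (Inverse.from pairing p) ,
      from (SeparateFactor.arc-right⇔ _ w w′)
           (subst (λ z → Arc (F′ z) w w′) (sym (Inverse.strictlyInverseˡ pairing p)) ww′) , λ
      { (inj₁ q) arc → cong inj₁ (trans (sym (Inverse.strictlyInverseʳ pairing q))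
                                        (cong (Inverse.from pairing) (only _ (to (SeparateFactor.arc-right⇔ q w w′) arc))))
      ; (inj₂ j) arc → ⊥-elim (Finₚ.0≢1+n (sym (onlyD′ (suc zero) (arc-D″ j w w′ arc)))) }
  ... | suc zero , ww′∈D″ , onlyD″ = viaD″ (proj₂ H-decomposes w w′ ww′∈D″)
    where
    viaD″ : (Σ (Fin t) λ j → Arc (H j) w w′ × (∀ j′ → Arc (H j′) w w′ → j′ ≡ j)) → UniqueFactor (s ↑ʳ w) (s ↑ʳ w′)
    viaD″ (j , ww′ , only) = inj₂ j , RotatedFactor.arc-H j w w′ ww′ , λ
      { (inj₁ q) arc → ⊥-elim (Finₚ.0≢1+n (onlyD″ zero (arc-D′ q w w′ arc)))
      ; (inj₂ j′) arc → cong inj₂ (only j′ (RotatedFactor.arc-right-right j′ w w′ arc)) }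

  uniqueFactor : ∀ u v → u ≢ v → UniqueFactor u v
  uniqueFactor u v u≢v with side {s} {t} u | side {s} {t} v
  ... | left a  | left a′  = unique-left-left a a′ (u≢v ∘ cong (_↑ˡ t))
  ... | left a  | right w  = unique-left-right a w
  ... | right w | left a   = unique-right-left a w
  ... | right w | right w′ = unique-right-right w w′ (u≢v ∘ cong (s ↑ʳ_))

  isFactor : ∀ z → SpanningSub (K* N) (Factor z) × CycleUnion m (Factor z)
  isFactor (inj₁ q) = SeparateFactor.isCycleFactor q
  isFactor (inj₂ j) = RotatedFactor.isCycleFactor j

  factorisation : CycleFactorisation N m
  factorisation =
    r + t , Factor ∘ splitAt r , ((proj₁ ∘ proj₁ ∘ isFactor ∘ splitAt r) , decomposes) , isFactor ∘ splitAt r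
    where
    decomposes : ∀ u v → u ≢ v → Σ (Fin (r + t)) λ z → Arc (Factor (splitAt r z)) u v ×
                                   (∀ z′ → Arc (Factor (splitAt r z′)) u v → z′ ≡ z)
    decomposes u v u≢v = let (z , uv , only) = uniqueFactor u v u≢v in
      join r t z , subst (λ y → Arc (Factor y) u v) (sym (Finₚ.splitAt-join r t z)) uv ,
      λ z′ uv′ → trans (sym (Finₚ.join-splitAt r t z′)) (cong (join r t) (only (splitAt r z′) uv′))

cycleFactorisation : ∀ {k ℓ} (m : Fin k → ℕ) (ℓ≤k : ℓ ≤ k) → (∀ i → 2 ≤ m i) →
  ∀ {s t} (s<t : s < t) → 0 < s → sumF (firstPart ℓ≤k m) ≡ s → sumF (lastPart ℓ≤k m) ≡ t →
  CycleFactorisation s (firstPart ℓ≤k m) → Condition2 ℓ ℓ≤k m s t s<t → CycleFactorisation (s + t) m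
cycleFactorisation m ℓ≤k 2≤m {suc s′} {suc t′} s<t (s≤s z≤n) sum-first sum-last (r , F , F-dec , F-factor)
  (D′ , D″ , D′D″-dec , (F′ , F′-dec , F′-factor) , sᵢ , tᵢ , sum-s , m≡ , H , H-dec , ρ , ρ-cyclic , Dᵢ , condition-d) =
  Construction.factorisation m ℓ≤k 2≤m sum-first sum-last F F-dec F-factor D′ D″ D′D″-dec F′ F′-dec F′-factor
    sᵢ tᵢ sum-s m≡ H H-dec ρ ρ-cyclic Dᵢ condition-d

proposition5p1 : (k ℓ : ℕ) (m : Fin k → ℕ) → 1 ≤ ℓ → (ℓ<k : ℓ < k) → (∀ i → 2 ≤ m i) →
    (s<t : sumF (firstPart (<⇒≤ ℓ<k) m) < sumF (lastPart (<⇒≤ ℓ<k) m)) →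
    OPstar (firstPart (<⇒≤ ℓ<k) m) →
    Condition2 ℓ (<⇒≤ ℓ<k) m (sumF (firstPart (<⇒≤ ℓ<k) m)) (sumF (lastPart (<⇒≤ ℓ<k) m)) s<t →
    OPstar m
proposition5p1 k (suc ℓ) m (s≤s z≤n) ℓ<k 2≤m s<t opFirst condition2 =
  subst (λ n → CycleFactorisation n m) (sym (sumF-firstPart-lastPart ℓ≤k m))
    (cycleFactorisation m ℓ≤k 2≤m s<t 0<s refl refl opFirst condition2)
  where
  ℓ≤k = <⇒≤ ℓ<k
  0<s : 0 < sumF (firstPart ℓ≤k m)
  0<s = ≤-trans (s≤s z≤n) (≤-trans (2≤m _) (≤-sumF (firstPart ℓ≤k m) zero))
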